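{- Start from the empty quadtree configuration and process a valid, aligned sequence of requests with the First Fit strategy. Then: (1) every insertion request is fulfilled at zero cost, i.e., when an $\ell$-square is to be inserted there is an empty $\ell$-pixel and no square is moved; (2) every deletion request is fulfilled (the deletion procedure terminates); (3) after every request the configuration satisfies the invariant: for every $i\in\mathbb{N}_0$ and every empty $i$-pixel $p$ there is no occupied $i$-pixel $q$ with $z(q)>z(p)$.
   Context: The unit square $[0,1]^2$ is recursively subdivided as a quadtree of unbounded depth: the root (layer $0$) is $[0,1]^2$, and every node (pixel) of layer $j$ is an axis-parallel square of side $2^{ -j}$ whose four children are its four quadrants. A pixel of layer $j$ is a $j$-pixel. For $r\in\mathbb{N}_0$, an $r$-square is an axis-parallel square of side $2^{ -r}$. A (quadtree) configuration assigns finitely many squares to pixels, each $j$-square to a $j$-pixel, at most one square per pixel, such that no pixel with an assigned square is a proper descendant of another pixel with an assigned square. A pixel contains a square if it is assigned to it or to a descendant. A pixel with an assigned square is occupied; a non-occupied pixel is blocked if some ancestor is occupied, free otherwise; a free pixel is empty if it contains no square; an empty pixel is maximally empty if its parent is not empty (an empty root counts as maximally empty). A move reassigns a $j$-square from its $j$-pixel to a $j$-pixel that is empty before the move. Z-order: the four children of every pixel are given the fixed z-curve (Morton) order (top-left, top-right, bottom-left, bottom-right); for pixels $p,q$ neither a descendant of the other, $z(p)<z(q)$ iff at their lowest common ancestor the child containing $p$ precedes the child containing $q$. Requests: $\textsc{Insert}(x)$ or $\textsc{Delete}(x)$, $x$ a unique identifier of a square of volume $v$ (deletions refer to present squares); volume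 $v$ resp. $-v$. A sequence $\sigma_1,\dots,\sigma_k$ is valid if all prefix sums of volumes are $\le 1$ and aligned if each $|\mathrm{vol}(\sigma_j)|=4^{ -\ell_j}$, $\ell_j\in\mathbb{N}_0$. The cost of a request is measured by the squares moved while fulfilling it. First Fit: an insertion of an $i$-square is handled by assigning it to the first empty $i$-pixel in z-order. A deletion of a square assigned to pixel $p$ unassigns it and then runs: set $S\gets\{p'\}$ with $p'$ the maximally empty pixel containing $p$; while $S\neq\varnothing$: let $a$ be the element of $S$ first in z-order, remove $a$ from $S$, let $b$ be the last occupied pixel in z-order; while $z(b)>z(a)$: if the square $B$ assigned to $b$ can be packed into $a$ (i.e., $a$ has an empty descendant, or is itself, a pixel of $B$'s layer), assign $B$ to the first such empty pixel inside $a$ in z-order, unassign $B$ from $b$, let $b'$ be the maximally empty pixel containing $b$, add $b'$ to $S$ and remove all children of $b'$ from $S$; then replace $b$ by the previous occupied pixel in z-order. -}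

module Defs where

open import Data.Nat as ℕ using (ℕ; zero; suc; _^_; _∸_; _<ᵇ_; _≡ᵇ_)
import Data.Nat.Properties as ℕP
open import Data.Fin using (Fin) renaming (_<_ to _<ᶠ_)
import Data.Fin.Properties as FP
open import Data.List using (List; []; _∷_; _++_; map; concatMap; allFin; length; foldl; take; inits)
import Data.List.Properties as LP
open import Data.List.Membership.Propositional using (_∈_; _∉_)
open import Data.Bool using (Bool; true; false; _∧_; _∨_; not; if_then_else_)
open import Data.Maybe using (Maybe; just; nothing; maybe)
import Data.Maybe as Maybe
open import Data.Product using (Σ; _×_; _,_; proj₁; proj₂)
open import Data.Rational as ℚ using (ℚ; normalize; 0ℚ; 1ℚ)
open import Relation.Nullary using (¬_)
open import Relation.Nullary.Decidable using (⌊_⌋)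
open import Relation.Binary.PropositionalEquality using (_≡_; _≢_)

-- A pixel is the path from the root: a list of child
-- indices.  Children of a pixel are numbered 0,1,2,3 = top-left,
-- top-right, bottom-left, bottom-right, i.e. in the fixed z-curve order.

Pixel : Set
Pixel = List (Fin 4)

layer : Pixel → ℕ
layer = length

_≼_ : Pixel → Pixel → Set
p ≼ q = Σ Pixel λ s → p ++ s ≡ q

_≺_ : Pixel → Pixel → Set
p ≺ q = p ≼ q × p ≢ q

-- z-order (only relates pixels neither of which is a descendant of the other):
-- at the lowest common ancestor the child containing p precedes the one containing q
data _<z_ : Pixel → Pixel → Set where
  z-here  : ∀ {a b p q} → a <ᶠ b → (a ∷ p) <z (b ∷ q)
  z-there : ∀ {a p q} → p <z q → (a ∷ p) <z (a ∷ q)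

-- Configurations: squares are named by identifiers (ℕ); a configuration
-- is a finite list of assignments (identifier , pixel).  A square assigned
-- to a j-pixel is a j-square (its layer is the layer of its pixel).

Config : Set
Config = List (ℕ × Pixel)

emptyConfig : Config
emptyConfig = []

assigned : Config → List Pixel
assigned = map proj₂

Occupied : Config → Pixel → Set
Occupied c p = p ∈ assigned c

Contains : Config → Pixel → Set
Contains c p = Σ Pixel λ q → Occupied c q × p ≼ q

Blocked : Config → Pixel → Set
Blocked c p = ¬ Occupied c p × (Σ Pixel λ q → Occupied c q × q ≺ p)

Free : Config → Pixel → Set
Free c p = ¬ Occupied c p × ¬ Blocked c p

Empty : Config → Pixel → Set
Empty c p = Free c p × ¬ Contains c p

Invariant : Config → Set
Invariant c = ∀ p q → Empty c p → Occupied c q → layer p ≡ layer q → ¬ (p <z q)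

filterB : ∀ {A : Set} → (A → Bool) → List A → List A
filterB f [] = []
filterB f (x ∷ xs) = if f x then x ∷ filterB f xs else filterB f xs

allB : ∀ {A : Set} → (A → Bool) → List A → Bool
allB f [] = true
allB f (x ∷ xs) = f x ∧ allB f xs

firstWith : ∀ {A : Set} → (A → Bool) → List A → Maybe A
firstWith f [] = nothing
firstWith f (x ∷ xs) = if f x then just x else firstWith f xs

_==ᵖ_ : Pixel → Pixel → Bool
p ==ᵖ q = ⌊ LP.≡-dec FP._≟_ p q ⌋

prefixB : Pixel → Pixel → Bool
prefixB [] _ = true
prefixB (_ ∷ _) [] = false
prefixB (a ∷ p) (b ∷ q) = ⌊ a FP.≟ b ⌋ ∧ prefixB p q

zltB : Pixel → Pixel → Bool
zltB (a ∷ p) (b ∷ q) = ⌊ a FP.<? b ⌋ ∨ (⌊ a FP.≟ b ⌋ ∧ zltB p q)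
zltB _ _ = false

-- total (pre-order) extension of the z-order, used to pick the first/last
-- element of a set of pixels; agrees with z-order on non-nested pixels
lexLt : Pixel → Pixel → Bool
lexLt p q = zltB p q ∨ (prefixB p q ∧ not (p ==ᵖ q))

-- empty  ⇔  no assigned pixel is an ancestor-or-self or descendant-or-self
isEmptyB : Config → Pixel → Bool
isEmptyB c p = allB (λ q → not (prefixB p q ∨ prefixB q p)) (assigned c)

-- the maximally empty pixel containing an (empty) pixel p:
-- its shortest empty ancestor-or-self
maxEmpty : Config → Pixel → Pixel
maxEmpty c p with firstWith (isEmptyB c) (inits p)
... | just a = a
... | nothing = p

allPaths : ℕ → List Pixel
allPaths zero = [] ∷ []
allPaths (suc k) = concatMap (λ i → map (i ∷_) (allPaths k)) (allFin 4)

firstEmptyIn : Config → Pixel → ℕ → Maybe Pixel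
firstEmptyIn c a ℓ =
  if ℓ <ᵇ length a then nothing
  else firstWith (isEmptyB c) (map (a ++_) (allPaths (ℓ ∸ length a)))

firstEmpty : Config → ℕ → Maybe Pixel
firstEmpty c ℓ = firstEmptyIn c [] ℓ

zmaxL : List Pixel → Maybe Pixel
zmaxL [] = nothing
zmaxL (p ∷ ps) with zmaxL ps
... | nothing = just p
... | just q = if lexLt q p then just p else just q

zminL : List Pixel → Maybe Pixel
zminL [] = nothing
zminL (p ∷ ps) with zminL ps
... | nothing = just p
... | just q = if lexLt p q then just p else just q

lastOcc : Config → Maybe Pixel
lastOcc c = zmaxL (assigned c)

prevOcc : Config → Pixel → Maybe Pixel
prevOcc c b = zmaxL (filterB (λ q → lexLt q b) (assigned c))

move : Config → Pixel → Pixel → Config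
move c b q = map (λ e → (proj₁ e , (if proj₂ e ==ᵖ b then q else proj₂ e))) c

isChild : Pixel → Pixel → Bool
isChild b s = prefixB b s ∧ (length s ≡ᵇ suc (length b))

lookupId : Config → ℕ → Maybe Pixel
lookupId [] x = nothing
lookupId ((y , p) ∷ c) x = if y ≡ᵇ x then just p else lookupId c x

removeId : Config → ℕ → Config
removeId c x = filterB (λ e → not (proj₁ e ≡ᵇ x)) c

-- First Fit deletion procedure, run with a fuel bound (every iteration of
-- either loop consumes one unit; out of fuel = nothing).  Since the
-- procedure is deterministic, "the deletion terminates" means: for some
-- fuel the run returns a configuration.

mutual
  outer : ℕ → List Pixel → Config → Maybe Config
  outer zero _ _ = nothing
  outer (suc n) S c with zminL S
  ... | nothing = just c
  ... | just a = inner n a (lastOcc c) (filterB (λ s → not (s ==ᵖ a)) S) c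

  inner : ℕ → Pixel → Maybe Pixel → List Pixel → Config → Maybe Config
  inner zero _ _ _ _ = nothing
  inner (suc n) a nothing S c = outer n S c
  inner (suc n) a (just b) S c =
    if zltB a b then pack n a b S c (firstEmptyIn c a (length b)) else outer n S c

  pack : ℕ → Pixel → Pixel → List Pixel → Config → Maybe Pixel → Maybe Config
  pack n a b S c nothing = inner n a (prevOcc c b) S c
  pack n a b S c (just q) =
    inner n a (prevOcc (move c b q) b)
      (maxEmpty (move c b q) b ∷
         filterB (λ s → not ((s ==ᵖ maxEmpty (move c b q) b) ∨ isChild (maxEmpty (move c b q) b) s)) S)
      (move c b q)

deleteFF : ℕ → Config → ℕ → Maybe Config
deleteFF n c x with lookupId c x
... | nothing = nothing
... | just p = outer n (maxEmpty (removeId c x) p ∷ []) (removeId c x)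

-- Requests.  An insertion carries the identifier and the layer ℓ of the
-- square (an ℓ-square, volume 4^-ℓ); so every request sequence is aligned
-- by construction.

data Request : Set where
  insert : (x ℓ : ℕ) → Request
  delete : (x : ℕ) → Request

-- one First Fit step (fuel used only by deletions)
ffStep : ℕ → Config → Request → Maybe Config
ffStep n c (insert x ℓ) = Maybe.map (λ p → (x , p) ∷ c) (firstEmpty c ℓ)
ffStep n c (delete x) = deleteFF n c x

data Run : Config → List Request → Config → Set where
  done : ∀ {c} → Run c [] c
  step : ∀ {c c′ c″ r rs} (n : ℕ) → ffStep n c r ≡ just c′ → Run c′ rs c″ → Run c (r ∷ rs) c″

-- present squares (identifier , layer)
applyReq : List (ℕ × ℕ) → Request → List (ℕ × ℕ)
applyReq s (insert x ℓ) = (x , ℓ) ∷ s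
applyReq s (delete x) = filterB (λ e → not (proj₁ e ≡ᵇ x)) s

live : List Request → List (ℕ × ℕ)
live = foldl applyReq []

lookupLayer : List (ℕ × ℕ) → ℕ → Maybe ℕ
lookupLayer [] x = nothing
lookupLayer ((y , ℓ) ∷ s) x = if y ≡ᵇ x then just ℓ else lookupLayer s x

Admissible : List (ℕ × ℕ) → Request → Set
Admissible s (insert x ℓ) = x ∉ map proj₁ s
Admissible s (delete x) = x ∈ map proj₁ s

WellFormed : List Request → Set
WellFormed rs = ∀ pre r post → rs ≡ pre ++ r ∷ post → Admissible (live pre) r

volOf : ℕ → ℚ
volOf ℓ = normalize 1 (4 ^ ℓ) {{ℕP.m^n≢0 4 ℓ}}

vol : List (ℕ × ℕ) → Request → ℚ
vol s (insert x ℓ) = volOf ℓ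
vol s (delete x) = maybe (λ ℓ → ℚ.- volOf ℓ) 0ℚ (lookupLayer s x)

volsFrom : List (ℕ × ℕ) → List Request → List ℚ
volsFrom s [] = []
volsFrom s (r ∷ rs) = vol s r ∷ volsFrom (applyReq s r) rs

sumℚ : List ℚ → ℚ
sumℚ [] = 0ℚ
sumℚ (q ∷ qs) = q ℚ.+ sumℚ qs

Valid : List Request → Set
Valid rs = ∀ k → sumℚ (take k (volsFrom [] rs)) ℚ.≤ 1ℚ

Handles : Config → Request → Set
Handles c (insert x ℓ) =
  Σ Pixel λ p → Empty c p × layer p ≡ ℓ × firstEmpty c ℓ ≡ just p
              × ffStep 0 c (insert x ℓ) ≡ just ((x , p) ∷ c)
              × Invariant ((x , p) ∷ c)
Handles c (delete x) =
  Σ ℕ λ n → Σ Config λ c′ → deleteFF n c x ≡ just c′ × Invariant c′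

module Submission where

-- The proof rests on one invariant: the configuration is compact, i.e. no
-- clear pixel (nested with no occupied pixel; the paper's "empty") precedes
-- an occupied pixel of its own layer in z-order.
-- Insertions (Counting, ClearCount, Volume, Requests): in a compact
-- configuration the numbers E(d) of clear d-pixels satisfy E(d+1) ≤ 4E(d)+3;
-- if no ℓ-pixel were clear, a deep layer would have fewer than 4^K clear
-- and at most Σ 4^(D−layer) covered pixels, which validity makes too few.
-- Deletions: a loop invariant (DeletionCorrect) keeps every violation of
-- compactness witnessed by a pending pixel, and the z-rank sum of occupied
-- pixels (DeletionTerminates) bounds the number of moves.

open import Defs
open import Data.List using (List; _++_; _∷_)
open import Data.Product using (Σ; _×_)
open import Relation.Binary.PropositionalEquality using (_≡_)

open import Data.Bool using (Bool; true; false; _∧_; _∨_; not; if_then_else_; T)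
open import Data.Empty using (⊥; ⊥-elim)
open import Data.Fin using (Fin; toℕ) renaming (_<_ to _<ᶠ_)
open import Data.Fin.Patterns using (0F; 1F; 2F; 3F)
import Data.Fin.Properties as FP
open import Data.Integer as ℤ using (ℤ)
import Data.Integer.GCD as ℤGCD
import Data.Integer.Properties as ℤP
import Data.Integer.Tactic.RingSolver as ℤSolver
open import Data.List using ([]; map; length; inits; replicate; take; foldl; allFin)
open import Data.List.Membership.Propositional using (_∈_; _∉_)
open import Data.List.Membership.Propositional.Properties using (∈-map⁺; ∈-map⁻; ∈-concat⁺′; ∈-concat⁻′; ∈-allFin)
import Data.List.Properties as LP
open import Data.List.Relation.Unary.All as All using (All; []; _∷_)
import Data.List.Relation.Unary.All.Properties as AllP
open import Data.List.Relation.Unary.AllPairs as AllPairs using (AllPairs; []; _∷_)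
import Data.List.Relation.Unary.AllPairs.Properties as AllPairsP
open import Data.List.Relation.Unary.Any using (here; there)
open import Data.Maybe using (Maybe; just; nothing)
open import Data.Maybe.Properties using (just-injective)
open import Data.Nat using (ℕ; zero; suc; _≤_; _<_; z≤n; s≤s; _∸_; _+_; _*_; _^_; _<ᵇ_; _≡ᵇ_)
open import Data.Nat.ListAction using (sum)
import Data.Nat.Properties as ℕP
open import Data.Nat.Tactic.RingSolver using (solve-∀)
open import Data.Product using (_,_; proj₁; proj₂)
open import Data.Rational as ℚ using (ℚ; 0ℚ; 1ℚ; ↥_; ↧_; toℚᵘ)
import Data.Rational.Properties as ℚP
open import Data.Rational.Unnormalised as ℚᵘ using (mkℚᵘ)
import Data.Rational.Unnormalised.Properties as ℚᵘP
open import Data.Sum using (_⊎_; inj₁; inj₂; [_,_])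
open import Data.Unit using (⊤; tt)
open import Relation.Binary using (tri<; tri≈; tri>)
open import Relation.Binary.PropositionalEquality using (_≢_; refl; sym; trans; cong; cong₂; subst; subst₂; module ≡-Reasoning)
open import Relation.Nullary using (¬_; Dec; yes; no)

module Pixels where

  infix 4 _⊑_
  data _⊑_ : Pixel → Pixel → Set where
    root⊑  : ∀ {q} → [] ⊑ q
    child⊑ : ∀ {a p q} → p ⊑ q → (a ∷ p) ⊑ (a ∷ q)

  ⊑-refl : ∀ {p} → p ⊑ p
  ⊑-refl {[]} = root⊑
  ⊑-refl {_ ∷ p} = child⊑ ⊑-refl

  ⊑-trans : ∀ {p q r} → p ⊑ q → q ⊑ r → p ⊑ r
  ⊑-trans root⊑ _ = root⊑
  ⊑-trans (child⊑ h) (child⊑ k) = child⊑ (⊑-trans h k)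

  ⊑-antisym : ∀ {p q} → p ⊑ q → q ⊑ p → p ≡ q
  ⊑-antisym root⊑ root⊑ = refl
  ⊑-antisym (child⊑ h) (child⊑ k) = cong (_ ∷_) (⊑-antisym h k)

  ⊑-layer : ∀ {p q} → p ⊑ q → length p ≤ length q
  ⊑-layer root⊑ = z≤n
  ⊑-layer (child⊑ h) = s≤s (⊑-layer h)

  ⊑-same-layer : ∀ {p q} → p ⊑ q → length p ≡ length q → p ≡ q
  ⊑-same-layer {q = []} root⊑ _ = refl
  ⊑-same-layer {q = _ ∷ _} root⊑ ()
  ⊑-same-layer (child⊑ h) e = cong (_ ∷_) (⊑-same-layer h (ℕP.suc-injective e))

  ⊑-++ : ∀ p s → p ⊑ p ++ s
  ⊑-++ [] s = root⊑
  ⊑-++ (a ∷ p) s = child⊑ (⊑-++ p s)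

  ⊑⇒≼ : ∀ {p q} → p ⊑ q → p ≼ q
  ⊑⇒≼ {q = q} root⊑ = q , refl
  ⊑⇒≼ (child⊑ h) with ⊑⇒≼ h
  ... | s , refl = s , refl

  ≼⇒⊑ : ∀ {p q} → p ≼ q → p ⊑ q
  ≼⇒⊑ {p} (s , refl) = ⊑-++ p s

  ⊑-common : ∀ {p q r} → p ⊑ r → q ⊑ r → p ⊑ q ⊎ q ⊑ p
  ⊑-common root⊑ _ = inj₁ root⊑
  ⊑-common (child⊑ _) root⊑ = inj₂ root⊑
  ⊑-common (child⊑ h) (child⊑ k) with ⊑-common h k
  ... | inj₁ x = inj₁ (child⊑ x)
  ... | inj₂ x = inj₂ (child⊑ x)

  Nested : Pixel → Pixel → Set
  Nested p q = p ⊑ q ⊎ q ⊑ p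

  nested-sym : ∀ {p q} → Nested p q → Nested q p
  nested-sym (inj₁ x) = inj₂ x
  nested-sym (inj₂ x) = inj₁ x

  <z-irrefl : ∀ {p} → ¬ (p <z p)
  <z-irrefl (z-here a<a) = FP.<-irrefl refl a<a
  <z-irrefl (z-there h) = <z-irrefl h

  <z-trans : ∀ {p q r} → p <z q → q <z r → p <z r
  <z-trans (z-here x) (z-here y) = z-here (FP.<-trans x y)
  <z-trans (z-here x) (z-there _) = z-here x
  <z-trans (z-there _) (z-here y) = z-here y
  <z-trans (z-there h) (z-there k) = z-there (<z-trans h k)

  <z-asym : ∀ {p q} → p <z q → ¬ (q <z p)
  <z-asym h k = <z-irrefl (<z-trans h k)

  <z-descʳ : ∀ {p q q′} → p <z q → q ⊑ q′ → p <z q′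
  <z-descʳ (z-here x) (child⊑ _) = z-here x
  <z-descʳ (z-there h) (child⊑ k) = z-there (<z-descʳ h k)

  <z-descˡ : ∀ {p q p′} → p <z q → p ⊑ p′ → p′ <z q
  <z-descˡ (z-here x) (child⊑ _) = z-here x
  <z-descˡ (z-there h) (child⊑ k) = z-there (<z-descˡ h k)

  <z-++ : ∀ a {p q} → p <z q → (a ++ p) <z (a ++ q)
  <z-++ [] h = h
  <z-++ (x ∷ a) h = z-there (<z-++ a h)

  <z-¬⊑ : ∀ {p q} → p <z q → ¬ (p ⊑ q)
  <z-¬⊑ (z-here x) (child⊑ _) = FP.<-irrefl refl x
  <z-¬⊑ (z-there h) (child⊑ k) = <z-¬⊑ h k

  <z-¬⊒ : ∀ {p q} → p <z q → ¬ (q ⊑ p)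
  <z-¬⊒ (z-here x) (child⊑ _) = FP.<-irrefl refl x
  <z-¬⊒ (z-there h) (child⊑ k) = <z-¬⊒ h k

  <z-¬nested : ∀ {p q} → p <z q → ¬ Nested p q
  <z-¬nested h (inj₁ x) = <z-¬⊑ h x
  <z-¬nested h (inj₂ x) = <z-¬⊒ h x

  data Position (p q : Pixel) : Set where
    ancestor   : p ⊑ q → Position p q
    descendant : q ⊑ p → Position p q
    before     : p <z q → Position p q
    after      : q <z p → Position p q

  position : ∀ p q → Position p q
  position [] q = ancestor root⊑
  position (a ∷ p) [] = descendant root⊑
  position (a ∷ p) (b ∷ q) with FP.<-cmp a b
  ... | tri< x _ _ = before (z-here x)
  ... | tri> _ _ x = after (z-here x)
  ... | tri≈ _ refl _ with position p q
  ... | ancestor x = ancestor (child⊑ x)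
  ... | descendant x = descendant (child⊑ x)
  ... | before x = before (z-there x)
  ... | after x = after (z-there x)

  <z-ancestor : ∀ {e q a} → e <z q → a ⊑ q → ¬ Nested e a → e <z a
  <z-ancestor {e} {q} {a} h k nn with position e a
  ... | ancestor x = ⊥-elim (nn (inj₁ x))
  ... | descendant x = ⊥-elim (nn (inj₂ x))
  ... | before x = x
  ... | after x = ⊥-elim (<z-asym h (<z-descˡ x k))

  same-layer-<z : ∀ p q → length p ≡ length q → p ≢ q → p <z q ⊎ q <z p
  same-layer-<z p q e ne with position p q
  ... | ancestor x = ⊥-elim (ne (⊑-same-layer x e))
  ... | descendant x = ⊥-elim (ne (sym (⊑-same-layer x (sym e))))
  ... | before x = inj₁ x
  ... | after x = inj₂ x

  -- The preorder traversal order: p ⊏ q if p precedes q in z-order or is a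
  -- proper ancestor of q.  It is the strict total order that Defs' lexLt
  -- decides; First Fit uses it to find the last occupied pixel.
  infix 4 _⊏_
  _⊏_ : Pixel → Pixel → Set
  p ⊏ q = p <z q ⊎ (p ⊑ q × p ≢ q)

  ⊏-irrefl : ∀ {p} → ¬ p ⊏ p
  ⊏-irrefl (inj₁ x) = <z-irrefl x
  ⊏-irrefl (inj₂ (_ , ne)) = ne refl

  ⊏-trans : ∀ {p q r} → p ⊏ q → q ⊏ r → p ⊏ r
  ⊏-trans (inj₁ x) (inj₁ y) = inj₁ (<z-trans x y)
  ⊏-trans (inj₁ x) (inj₂ (y , _)) = inj₁ (<z-descʳ x y)
  ⊏-trans {p} {q} {r} (inj₂ (x , ne)) (inj₁ y) with position p r
  ... | ancestor z = inj₂ (z , λ { refl → <z-¬⊒ y x })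
  ... | descendant z = ⊥-elim (<z-¬⊒ y (⊑-trans z x))
  ... | before z = inj₁ z
  ... | after z = ⊥-elim (<z-asym y (<z-descʳ z x))
  ⊏-trans (inj₂ (x , ne)) (inj₂ (y , ne′)) =
    inj₂ (⊑-trans x y , λ { refl → ne (⊑-antisym x y) })

  ⊏-total : ∀ p q → p ≢ q → p ⊏ q ⊎ q ⊏ p
  ⊏-total p q ne with position p q
  ... | ancestor x = inj₁ (inj₂ (x , ne))
  ... | descendant x = inj₂ (inj₂ (x , λ e → ne (sym e)))
  ... | before x = inj₁ (inj₁ x)
  ... | after x = inj₂ (inj₁ x)

  <z-⊏ : ∀ {a b q} → a <z q → q ⊏ b → a <z b
  <z-⊏ h (inj₁ x) = <z-trans h x
  <z-⊏ h (inj₂ (x , _)) = <z-descʳ h x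

module Decisions where

  open Pixels

  ∧-true : ∀ {a b} → (a ∧ b) ≡ true → a ≡ true × b ≡ true
  ∧-true {true} {true} _ = refl , refl

  ∨-true : ∀ {a b} → (a ∨ b) ≡ true → a ≡ true ⊎ b ≡ true
  ∨-true {true} _ = inj₁ refl
  ∨-true {false} e = inj₂ e

  true≢false : true ≢ false
  true≢false ()

  _≟ᵖ_ : (p q : Pixel) → Dec (p ≡ q)
  _≟ᵖ_ = LP.≡-dec FP._≟_

  ⊏-trichotomy : ∀ p q → p ≡ q ⊎ p ⊏ q ⊎ q ⊏ p
  ⊏-trichotomy p q with p ≟ᵖ q
  ... | yes e = inj₁ e
  ... | no ne = inj₂ (⊏-total p q ne)

  prefixB-sound : ∀ p q → prefixB p q ≡ true → p ⊑ q
  prefixB-sound [] q e = root⊑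
  prefixB-sound (a ∷ p) [] ()
  prefixB-sound (a ∷ p) (b ∷ q) e with a FP.≟ b
  prefixB-sound (a ∷ p) (.a ∷ q) e | yes refl = child⊑ (prefixB-sound p q e)
  prefixB-sound (a ∷ p) (b ∷ q) () | no _

  prefixB-complete : ∀ {p q} → p ⊑ q → prefixB p q ≡ true
  prefixB-complete root⊑ = refl
  prefixB-complete {a ∷ p} {.a ∷ q} (child⊑ h) with a FP.≟ a
  ... | yes _ = prefixB-complete h
  ... | no ne = ⊥-elim (ne refl)

  prefixB-false : ∀ {p q} → ¬ (p ⊑ q) → prefixB p q ≡ false
  prefixB-false {p} {q} ne with prefixB p q in eq
  ... | true = ⊥-elim (ne (prefixB-sound p q eq))
  ... | false = refl

  nested? : ∀ p q → Nested p q ⊎ ¬ Nested p q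
  nested? p q with prefixB p q in e₁ | prefixB q p in e₂
  ... | true | _ = inj₁ (inj₁ (prefixB-sound p q e₁))
  ... | _ | true = inj₁ (inj₂ (prefixB-sound q p e₂))
  ... | false | false = inj₂ λ { (inj₁ y) → true≢false (trans (sym (prefixB-complete y)) e₁)
                                ; (inj₂ y) → true≢false (trans (sym (prefixB-complete y)) e₂) }

  zltB-sound : ∀ p q → zltB p q ≡ true → p <z q
  zltB-sound [] q ()
  zltB-sound (a ∷ p) [] ()
  zltB-sound (a ∷ p) (b ∷ q) e with a FP.<? b
  ... | yes x = z-here x
  ... | no _ with a FP.≟ b
  zltB-sound (a ∷ p) (.a ∷ q) e | no _ | yes refl = z-there (zltB-sound p q e)
  zltB-sound (a ∷ p) (b ∷ q) () | no _ | no _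

  zltB-complete : ∀ {p q} → p <z q → zltB p q ≡ true
  zltB-complete {a ∷ p} {b ∷ q} (z-here x) with a FP.<? b
  ... | yes _ = refl
  ... | no nx = ⊥-elim (nx x)
  zltB-complete {a ∷ p} {.a ∷ q} (z-there h) with a FP.<? a
  ... | yes _ = refl
  ... | no _ with a FP.≟ a
  ... | yes _ = zltB-complete h
  ... | no ne = ⊥-elim (ne refl)

  ==-sound : ∀ p q → (p ==ᵖ q) ≡ true → p ≡ q
  ==-sound p q e with p ≟ᵖ q
  ... | yes x = x
  ==-sound p q () | no _

  ==-refl : ∀ p → (p ==ᵖ p) ≡ true
  ==-refl p with p ≟ᵖ p
  ... | yes _ = refl
  ... | no ne = ⊥-elim (ne refl)

  ==-false : ∀ {p q} → p ≢ q → (p ==ᵖ q) ≡ false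
  ==-false {p} {q} ne with p ≟ᵖ q
  ... | yes x = ⊥-elim (ne x)
  ... | no _ = refl

  lexLt-sound : ∀ p q → lexLt p q ≡ true → p ⊏ q
  lexLt-sound p q e with ∨-true {zltB p q} e
  ... | inj₁ x = inj₁ (zltB-sound p q x)
  ... | inj₂ x with ∧-true {prefixB p q} x
  ... | p⊑q , p≠q = inj₂ (prefixB-sound p q p⊑q , distinct p≠q)
    where
    distinct : not (p ==ᵖ q) ≡ true → p ≢ q
    distinct w refl rewrite ==-refl p = true≢false (sym w)

  lexLt-complete : ∀ {p q} → p ⊏ q → lexLt p q ≡ true
  lexLt-complete (inj₁ x) rewrite zltB-complete x = refl
  lexLt-complete {p} {q} (inj₂ (x , ne)) rewrite prefixB-complete x | ==-false ne with zltB p q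
  ... | true = refl
  ... | false = refl

  lexLt-irrefl : ∀ p → lexLt p p ≡ false
  lexLt-irrefl p with lexLt p p in eq
  ... | true = ⊥-elim (⊏-irrefl (lexLt-sound p p eq))
  ... | false = refl

  filterB-∈ : ∀ {A : Set} (f : A → Bool) {x} xs → x ∈ filterB f xs → x ∈ xs × f x ≡ true
  filterB-∈ f (y ∷ xs) m with f y in eq
  filterB-∈ f (y ∷ xs) (here refl) | true = here refl , eq
  filterB-∈ f (y ∷ xs) (there m) | true with filterB-∈ f xs m
  ... | a , b = there a , b
  filterB-∈ f (y ∷ xs) m | false with filterB-∈ f xs m
  ... | a , b = there a , b

  ∈-filterB : ∀ {A : Set} (f : A → Bool) {x} xs → x ∈ xs → f x ≡ true → x ∈ filterB f xs
  ∈-filterB f (y ∷ xs) (here refl) e rewrite e = here refl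
  ∈-filterB f (y ∷ xs) (there m) e with f y
  ... | true = there (∈-filterB f xs m e)
  ... | false = ∈-filterB f xs m e

  allB-sound : ∀ {A : Set} (f : A → Bool) xs → allB f xs ≡ true → ∀ {x} → x ∈ xs → f x ≡ true
  allB-sound f (y ∷ xs) e (here refl) = proj₁ (∧-true {f y} e)
  allB-sound f (y ∷ xs) e (there m) = allB-sound f xs (proj₂ (∧-true {f y} e)) m

  allB-complete : ∀ {A : Set} (f : A → Bool) xs → (∀ {x} → x ∈ xs → f x ≡ true) → allB f xs ≡ true
  allB-complete f [] h = refl
  allB-complete f (y ∷ xs) h rewrite h (here refl) = allB-complete f xs (λ m → h (there m))

  allB-witness : ∀ {A : Set} (f : A → Bool) xs → allB f xs ≡ false → Σ A λ x → x ∈ xs × f x ≡ false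
  allB-witness f (y ∷ xs) e with f y in ey
  ... | false = y , here refl , ey
  ... | true with allB-witness f xs e
  ... | x , m , fx = x , there m , fx

  firstWith-just : ∀ {A : Set} (f : A → Bool) xs {y} → firstWith f xs ≡ just y → y ∈ xs × f y ≡ true
  firstWith-just f (x ∷ xs) e with f x in eq
  firstWith-just f (x ∷ xs) refl | true = here refl , eq
  ... | false with firstWith-just f xs e
  ... | a , b = there a , b

  firstWith-nothing : ∀ {A : Set} (f : A → Bool) xs → firstWith f xs ≡ nothing →
    ∀ {x} → x ∈ xs → f x ≡ false
  firstWith-nothing f (y ∷ xs) e m with f y in eq
  firstWith-nothing f (y ∷ xs) () m | true
  firstWith-nothing f (y ∷ xs) e (here refl) | false = eq
  firstWith-nothing f (y ∷ xs) e (there m) | false = firstWith-nothing f xs e m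

  firstWith-least : ∀ {A : Set} {R : A → A → Set} (f : A → Bool) xs → AllPairs R xs → ∀ {y} →
    firstWith f xs ≡ just y → ∀ {x} → x ∈ xs → f x ≡ true → x ≡ y ⊎ R y x
  firstWith-least f (z ∷ xs) (a ∷ s) e m fx with f z in eq
  firstWith-least f (z ∷ xs) (a ∷ s) refl (here refl) fx | true = inj₁ refl
  firstWith-least f (z ∷ xs) (a ∷ s) refl (there m) fx | true = inj₂ (All.lookup a m)
  firstWith-least f (z ∷ xs) (a ∷ s) e (here refl) fx | false = ⊥-elim (true≢false (trans (sym fx) eq))
  firstWith-least f (z ∷ xs) (a ∷ s) e (there m) fx | false = firstWith-least f xs s e m fx

  zmaxL-nothing : ∀ ps → zmaxL ps ≡ nothing → ps ≡ []
  zmaxL-nothing [] _ = refl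
  zmaxL-nothing (p ∷ ps) e with zmaxL ps
  zmaxL-nothing (p ∷ ps) () | nothing
  ... | just q with lexLt q p
  zmaxL-nothing (p ∷ ps) () | just q | true
  zmaxL-nothing (p ∷ ps) () | just q | false

  zmaxL-just : ∀ ps {m} → zmaxL ps ≡ just m → m ∈ ps × (∀ {x} → x ∈ ps → x ≡ m ⊎ x ⊏ m)
  zmaxL-just (p ∷ ps) e with zmaxL ps in eq
  zmaxL-just (p ∷ ps) refl | nothing rewrite zmaxL-nothing ps eq = here refl , λ { (here refl) → inj₁ refl }
  ... | just q with zmaxL-just ps eq | lexLt q p in lq
  zmaxL-just (p ∷ ps) refl | just q | (mq , hq) | true = here refl , λ
    { (here refl) → inj₁ refl
    ; (there m) → inj₂ ([ (λ { refl → lexLt-sound q p lq }) , (λ l → ⊏-trans l (lexLt-sound q p lq)) ] (hq m)) }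
  zmaxL-just (p ∷ ps) refl | just q | (mq , hq) | false = there mq , λ
    { (here refl) → p≤q
    ; (there m) → hq m }
    where
    p≤q : p ≡ q ⊎ p ⊏ q
    p≤q with ⊏-trichotomy p q
    ... | inj₁ x = inj₁ x
    ... | inj₂ (inj₁ l) = inj₂ l
    ... | inj₂ (inj₂ l) = ⊥-elim (true≢false (trans (sym (lexLt-complete l)) lq))

  zminL-nothing : ∀ ps → zminL ps ≡ nothing → ps ≡ []
  zminL-nothing [] _ = refl
  zminL-nothing (p ∷ ps) e with zminL ps
  zminL-nothing (p ∷ ps) () | nothing
  ... | just q with lexLt p q
  zminL-nothing (p ∷ ps) () | just q | true
  zminL-nothing (p ∷ ps) () | just q | false

  zminL-just : ∀ ps {m} → zminL ps ≡ just m → m ∈ ps × (∀ {x} → x ∈ ps → x ≡ m ⊎ m ⊏ x)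
  zminL-just (p ∷ ps) e with zminL ps in eq
  zminL-just (p ∷ ps) refl | nothing rewrite zminL-nothing ps eq = here refl , λ { (here refl) → inj₁ refl }
  ... | just q with zminL-just ps eq | lexLt p q in lq
  zminL-just (p ∷ ps) refl | just q | (mq , hq) | true = here refl , λ
    { (here refl) → inj₁ refl
    ; (there m) → inj₂ ([ (λ { refl → lexLt-sound p q lq }) , (λ l → ⊏-trans (lexLt-sound p q lq) l) ] (hq m)) }
  zminL-just (p ∷ ps) refl | just q | (mq , hq) | false = there mq , λ
    { (here refl) → q≤p
    ; (there m) → hq m }
    where
    q≤p : p ≡ q ⊎ q ⊏ p
    q≤p with ⊏-trichotomy p q
    ... | inj₁ x = inj₁ x
    ... | inj₂ (inj₂ l) = inj₂ l
    ... | inj₂ (inj₁ l) = ⊥-elim (true≢false (trans (sym (lexLt-complete l)) lq))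

module Emptiness where

  open Pixels
  open Decisions

  inits-⊑ : ∀ {e} p → e ∈ inits p → e ⊑ p
  inits-⊑ [] (here refl) = root⊑
  inits-⊑ (a ∷ p) (here refl) = root⊑
  inits-⊑ {e} (a ∷ p) (there m) = below (∈-map⁻ (a ∷_) m′)
    where
    -- inits (a ∷ p) unfolds to [] ∷ map (a ∷_) (inits p).
    m′ : e ∈ map (a ∷_) (inits p)
    m′ = m
    below : Σ Pixel (λ x → x ∈ inits p × e ≡ a ∷ x) → e ⊑ a ∷ p
    below (x , mx , refl) = child⊑ (inits-⊑ p mx)

  ⊑-inits : ∀ {e p} → e ⊑ p → e ∈ inits p
  ⊑-inits {p = []} root⊑ = here refl
  ⊑-inits {p = a ∷ p} root⊑ = here refl
  ⊑-inits {p = a ∷ p} (child⊑ h) = there (∈-map⁺ (a ∷_) (⊑-inits h))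

  inits-sorted : ∀ p → AllPairs _⊑_ (inits p)
  inits-sorted [] = [] ∷ []
  inits-sorted (a ∷ p) = All.tabulate (λ _ → root⊑) ∷ AllPairsP.map⁺ (AllPairs.map child⊑ (inits-sorted p))

  allPaths-layer : ∀ k {p} → p ∈ allPaths k → length p ≡ k
  allPaths-layer zero (here refl) = refl
  allPaths-layer (suc k) m with ∈-concat⁻′ (map (λ i → map (i ∷_) (allPaths k)) (allFin 4)) m
  ... | _ , p∈block , block∈ with ∈-map⁻ (λ i → map (i ∷_) (allPaths k)) block∈
  ... | i , _ , refl with ∈-map⁻ (i ∷_) p∈block
  ... | q , q∈ , refl = cong suc (allPaths-layer k q∈)

  ∈-allPaths : ∀ p → p ∈ allPaths (length p)
  ∈-allPaths [] = here refl
  ∈-allPaths (i ∷ p) = ∈-concat⁺′ (∈-map⁺ (i ∷_) (∈-allPaths p)) (∈-map⁺ (λ j → map (j ∷_) (allPaths (length p))) (∈-allFin i))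

  allPaths-sorted : ∀ k → AllPairs _<z_ (allPaths k)
  allPaths-sorted zero = [] ∷ []
  allPaths-sorted (suc k) = AllPairsP.concat⁺ each-sorted blocks-sorted
    where
    block : Fin 4 → List Pixel
    block i = map (i ∷_) (allPaths k)
    each-sorted : All (AllPairs _<z_) (map block (allFin 4))
    each-sorted = AllP.map⁺ (All.tabulate (λ {i} _ → block-sorted i))
      where
      block-sorted : ∀ i → AllPairs _<z_ (block i)
      block-sorted i = AllPairsP.map⁺ (AllPairs.map z-there (allPaths-sorted k))
    blocks-ordered : ∀ {i j} → i <ᶠ j → All (λ x → All (x <z_) (block j)) (block i)
    blocks-ordered i<j = AllP.map⁺ (All.tabulate (λ _ → AllP.map⁺ (All.tabulate (λ _ → z-here i<j))))
    blocks-sorted : AllPairs (λ xs ys → All (λ x → All (x <z_) ys) xs) (map block (allFin 4))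
    blocks-sorted = AllPairsP.map⁺ (AllPairsP.tabulate⁺-< {f = λ i → i} blocks-ordered)

  -- p is clear in c if no occupied pixel is nested with p; this is the
  -- structural form of Defs' Empty (see Empty⇒Clear, Clear⇒Empty) and what
  -- isEmptyB decides.
  Clear : Config → Pixel → Set
  Clear c p = ∀ {x} → x ∈ assigned c → ¬ Nested p x

  isEmptyB-sound : ∀ c p → isEmptyB c p ≡ true → Clear c p
  isEmptyB-sound c p e {x} m n = reject (allB-sound _ (assigned c) e m) n
    where
    reject : not (prefixB p x ∨ prefixB x p) ≡ true → Nested p x → ⊥
    reject h (inj₁ y) rewrite prefixB-complete y with h
    ... | ()
    reject h (inj₂ y) rewrite prefixB-complete y with prefixB p x
    reject () (inj₂ y) | true
    reject () (inj₂ y) | false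

  isEmptyB-complete : ∀ c p → Clear c p → isEmptyB c p ≡ true
  isEmptyB-complete c p h = allB-complete _ (assigned c) λ {x} m →
    accept (prefixB-false (λ y → h m (inj₁ y))) (prefixB-false (λ y → h m (inj₂ y)))
    where
    accept : ∀ {a b} → a ≡ false → b ≡ false → not (a ∨ b) ≡ true
    accept refl refl = refl

  isEmptyB-false : ∀ c p → ¬ Clear c p → isEmptyB c p ≡ false
  isEmptyB-false c p ne with isEmptyB c p in eq
  ... | true = ⊥-elim (ne (isEmptyB-sound c p eq))
  ... | false = refl

  not-clear-witness : ∀ c p → isEmptyB c p ≡ false → Σ Pixel λ x → x ∈ assigned c × Nested p x
  not-clear-witness c p e with allB-witness _ (assigned c) e
  ... | x , m , fx = x , m , nested (prefixB p x) (prefixB x p) refl refl fx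
    where
    nested : ∀ u v → prefixB p x ≡ u → prefixB x p ≡ v → not (u ∨ v) ≡ false → Nested p x
    nested true _ e₁ _ _ = inj₁ (prefixB-sound p x e₁)
    nested false true _ e₂ _ = inj₂ (prefixB-sound x p e₂)
    nested false false _ _ ()

  Empty⇒Clear : ∀ {c p} → Empty c p → Clear c p
  Empty⇒Clear ((nocc , nblk) , ncont) {x} m (inj₁ y) = ncont (x , m , ⊑⇒≼ y)
  Empty⇒Clear {c} {p} ((nocc , nblk) , ncont) {x} m (inj₂ y) with x ≟ᵖ p
  ... | yes refl = nocc m
  ... | no ne = nblk (nocc , x , m , (⊑⇒≼ y , ne))

  Clear⇒Empty : ∀ {c p} → Clear c p → Empty c p
  Clear⇒Empty h = ((λ occ → h occ (inj₁ ⊑-refl)) , (λ { (_ , q , occ , (le , _)) → h occ (inj₂ (≼⇒⊑ le)) })) ,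
                  (λ { (q , occ , le) → h occ (inj₁ (≼⇒⊑ le)) })

  Clear-desc : ∀ {c p p′} → Clear c p → p ⊑ p′ → Clear c p′
  Clear-desc h le m (inj₁ y) = h m (inj₁ (⊑-trans le y))
  Clear-desc h le m (inj₂ y) = h m (⊑-common le y)

  Compact : Config → Set
  Compact c = ∀ {e q} → Clear c e → q ∈ assigned c → length e ≡ length q → ¬ (e <z q)

  Compact⇒Invariant : ∀ {c} → Compact c → Invariant c
  Compact⇒Invariant h p q e o l = h (Empty⇒Clear e) o l

  maxEmpty-top : ∀ c p {e} → Clear c e → e ⊑ p → Clear c (maxEmpty c p) × maxEmpty c p ⊑ e
  maxEmpty-top c p {e} h le with firstWith (isEmptyB c) (inits p) in eq
  ... | just a = isEmptyB-sound c a (proj₂ (firstWith-just (isEmptyB c) (inits p) eq)) , a⊑e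
    where
    a⊑e : a ⊑ e
    a⊑e with firstWith-least (isEmptyB c) (inits p) (inits-sorted p) eq (⊑-inits le) (isEmptyB-complete c e h)
    ... | inj₁ refl = ⊑-refl
    ... | inj₂ x = x
  ... | nothing = ⊥-elim (true≢false (trans (sym (isEmptyB-complete c e h))
                    (firstWith-nothing (isEmptyB c) (inits p) eq (⊑-inits le))))

  below-enumerated : ∀ a ℓ t → length (a ++ t) ≡ ℓ → (a ++ t) ∈ map (a ++_) (allPaths (ℓ ∸ length a))
  below-enumerated a ℓ t le = ∈-map⁺ (a ++_) (subst (λ k → t ∈ allPaths k) t-layer (∈-allPaths t))
    where
    t-layer : length t ≡ ℓ ∸ length a
    t-layer = trans (sym (ℕP.m+n∸m≡n (length a) (length t))) (cong (_∸ length a) (trans (sym (LP.length-++ a)) le))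

  firstEmptyIn-just : ∀ c a ℓ {q} → firstEmptyIn c a ℓ ≡ just q →
    a ⊑ q × length q ≡ ℓ × Clear c q × (∀ {e} → a ⊑ e → length e ≡ ℓ → Clear c e → ¬ (e <z q))
  firstEmptyIn-just c a ℓ eq with ℓ <ᵇ length a in lt
  firstEmptyIn-just c a ℓ () | true
  ... | false with firstWith-just (isEmptyB c) (map (a ++_) (allPaths (ℓ ∸ length a))) eq
  ... | m , clear with ∈-map⁻ (a ++_) m
  ... | s , ms , refl = ⊑-++ a s , layer-q , isEmptyB-sound c _ clear , first
    where
    a≤ℓ : length a ≤ ℓ
    a≤ℓ = ℕP.≮⇒≥ (λ l → subst T lt (ℕP.<⇒<ᵇ l))
    layer-q : length (a ++ s) ≡ ℓ
    layer-q = trans (LP.length-++ a) (trans (cong (length a +_) (allPaths-layer _ ms)) (ℕP.m+[n∸m]≡n a≤ℓ))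
    sorted : AllPairs _<z_ (map (a ++_) (allPaths (ℓ ∸ length a)))
    sorted = AllPairsP.map⁺ (AllPairs.map (<z-++ a) (allPaths-sorted (ℓ ∸ length a)))
    first : ∀ {e} → a ⊑ e → length e ≡ ℓ → Clear c e → ¬ (e <z (a ++ s))
    first {e} ae le he e<q with ⊑⇒≼ ae
    ... | t , refl with firstWith-least (isEmptyB c) _ sorted eq (below-enumerated a ℓ t le) (isEmptyB-complete c _ he)
    ... | inj₁ x = <z-irrefl (subst (λ w → w <z (a ++ s)) x e<q)
    ... | inj₂ x = <z-asym x e<q

  firstEmptyIn-nothing : ∀ c a ℓ → firstEmptyIn c a ℓ ≡ nothing → ∀ {e} → a ⊑ e → length e ≡ ℓ → ¬ Clear c e
  firstEmptyIn-nothing c a ℓ eq {e} ae le he with ℓ <ᵇ length a in lt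
  ... | true = ℕP.<⇒≱ (ℕP.<ᵇ⇒< ℓ (length a) (subst T (sym lt) tt)) (subst (length a ≤_) le (⊑-layer ae))
  ... | false with ⊑⇒≼ ae
  ... | t , refl = true≢false (trans (sym (isEmptyB-complete c _ he))
                     (firstWith-nothing (isEmptyB c) _ eq (below-enumerated a ℓ t le)))

module Moves where

  open Pixels
  open Decisions
  open Emptiness

  -- In every reachable configuration the occupied pixels form an antichain:
  -- no two of them are nested.
  Antichain : List Pixel → Set
  Antichain = AllPairs (λ p q → ¬ Nested p q)

  antichain-unnested : ∀ {ps b y} → Antichain ps → b ∈ ps → y ∈ ps → y ≢ b → ¬ Nested b y
  antichain-unnested w (here refl) (here refl) ne _ = ne refl
  antichain-unnested (h ∷ _) (here refl) (there m) ne = All.lookup h m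
  antichain-unnested (h ∷ _) (there m) (here refl) ne n = All.lookup h m (nested-sym n)
  antichain-unnested (_ ∷ w) (there m) (there k) ne = antichain-unnested w m k ne

  -- The squares of a configuration as (identifier , layer) pairs; First Fit
  -- must keep them equal to the squares that are present.
  squares : Config → List (ℕ × ℕ)
  squares = map (λ e → proj₁ e , length (proj₂ e))

  move-∈ : ∀ c b q {x} → x ∈ assigned (move c b q) → x ≡ q ⊎ (x ∈ assigned c × x ≢ b)
  move-∈ ((i , p) ∷ c) b q m with p ==ᵖ b in eq
  move-∈ ((i , p) ∷ c) b q (here refl) | true = inj₁ refl
  move-∈ ((i , p) ∷ c) b q (here refl) | false =
    inj₂ (here refl , λ { refl → true≢false (trans (sym (==-refl p)) eq) })
  move-∈ ((i , p) ∷ c) b q (there m) | _ with move-∈ c b q m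
  ... | inj₁ x = inj₁ x
  ... | inj₂ (y , z) = inj₂ (there y , z)

  ∈-move : ∀ c b q {y} → y ∈ assigned c → y ≢ b → y ∈ assigned (move c b q)
  ∈-move ((i , p) ∷ c) b q (here refl) ne rewrite ==-false ne = here refl
  ∈-move ((i , p) ∷ c) b q (there m) ne = there (∈-move c b q m ne)

  move-target : ∀ c b q → b ∈ assigned c → q ∈ assigned (move c b q)
  move-target ((i , p) ∷ c) b q (here refl) rewrite ==-refl p = here refl
  move-target ((i , p) ∷ c) b q (there m) = there (move-target c b q m)

  move-absent : ∀ c b q → (∀ {y} → y ∈ assigned c → y ≢ b) → move c b q ≡ c
  move-absent [] b q h = refl
  move-absent ((i , p) ∷ c) b q h rewrite ==-false (h (here refl)) =
    cong ((i , p) ∷_) (move-absent c b q (λ m → h (there m)))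

  move-antichain : ∀ c b q → Antichain (assigned c) → Clear c q → Antichain (assigned (move c b q))
  move-antichain [] b q w h = []
  move-antichain ((i , p) ∷ c) b q (w₁ ∷ w₂) h with p ==ᵖ b in eq
  ... | true rewrite ==-sound p b eq | move-absent c b q (λ m e → All.lookup w₁ m (inj₁ (subst (b ⊑_) (sym e) ⊑-refl))) =
        All.tabulate (λ m → h (there m)) ∷ w₂
  ... | false = All.tabulate (λ m n → disjoint (move-∈ c b q m) n) ∷ move-antichain c b q w₂ (λ m → h (there m))
    where
    disjoint : ∀ {x} → x ≡ q ⊎ (x ∈ assigned c × x ≢ b) → ¬ Nested p x
    disjoint (inj₁ refl) n = h (here refl) (nested-sym n)
    disjoint (inj₂ (m , _)) n = All.lookup w₁ m n

  move-squares : ∀ c b q → length q ≡ length b → squares (move c b q) ≡ squares c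
  move-squares [] b q e = refl
  move-squares ((i , p) ∷ c) b q e with p ==ᵖ b in eq
  ... | true rewrite ==-sound p b eq = cong₂ _∷_ (cong (i ,_) e) (move-squares c b q e)
  ... | false = cong ((i , length p) ∷_) (move-squares c b q e)

  clear-after-move : ∀ c b q {e} → Clear (move c b q) e → Clear c e ⊎ Nested e b
  clear-after-move c b q {e} h with nested? e b
  ... | inj₁ n = inj₂ n
  ... | inj₂ nn = inj₁ disjoint
    where
    disjoint : ∀ {x} → x ∈ assigned c → ¬ Nested e x
    disjoint {x} m n with x ≟ᵖ b
    ... | yes refl = nn n
    ... | no ne = h (∈-move c b q m ne) n

module DeletionCorrect where

  open Pixels
  open Decisions
  open Emptiness
  open Moves

  -- A violation of
  -- compactness is a clear pixel e before an occupied pixel q of its layer.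
  -- The outer loop maintains that every violation is witnessed by a pending
  -- pixel s ∈ S (s ⊑ e but not s ⊑ q); hence when S is exhausted the
  -- configuration is compact.

  Witnessed : List Pixel → Config → Set
  Witnessed S c = ∀ {e q} → Clear c e → q ∈ assigned c → length e ≡ length q → e <z q →
                    Σ Pixel λ s → s ∈ S × s ⊑ e × ¬ (s ⊑ q)

  -- q is still to be examined by the inner loop, whose cursor is at mb and
  -- runs backwards in traversal order.
  Unscanned : Maybe Pixel → Pixel → Set
  Unscanned nothing q = ⊥
  Unscanned (just b) q = q ≡ b ⊎ q ⊏ b

  CursorOccupied : Maybe Pixel → Config → Set
  CursorOccupied nothing c = ⊤
  CursorOccupied (just b) c = b ∈ assigned c

  -- No pixel inside a of q's layer is clear: q cannot be packed into a.
  Unpackable : Config → Pixel → Pixel → Set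
  Unpackable c a q = ∀ {e} → a ⊑ e → length e ≡ length q → ¬ Clear c e

  record InnerInv (a : Pixel) (mb : Maybe Pixel) (S : List Pixel) (c : Config) : Set where
    field
      antichain  : Antichain (assigned c)
      violations : ∀ {e q} → Clear c e → q ∈ assigned c → length e ≡ length q → e <z q →
                     (a ⊑ e × ¬ (a ⊑ q)) ⊎ (Σ Pixel λ s → s ∈ S × s ⊑ e × ¬ (s ⊑ q))
      scanned    : ∀ {q} → q ∈ assigned c → a <z q → Unscanned mb q ⊎ Unpackable c a q
      pending    : ∀ {s} → s ∈ S → a ⊏ s
      cursor     : CursorOccupied mb c
  open InnerInv

  Result : Config → Config → Set
  Result c c′ = Compact c′ × Antichain (assigned c′) × squares c′ ≡ squares c

  ancestor-before : ∀ {c e q a} → Clear c e → q ∈ assigned c → a ⊑ e → e <z q → ¬ (a ⊑ q) → a <z q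
  ancestor-before {q = q} {a = a} he m ae e<q naq with position a q
  ... | ancestor x = ⊥-elim (naq x)
  ... | descendant x = ⊥-elim (he m (inj₂ (⊑-trans x ae)))
  ... | before x = x
  ... | after x = ⊥-elim (<z-asym e<q (<z-descʳ x ae))

  inner-exit : ∀ {a mb S c} → InnerInv a mb S c →
    (∀ {q} → q ∈ assigned c → a <z q → ¬ Unscanned mb q) → Witnessed S c
  inner-exit I stopped he m l e<q with violations I he m l e<q
  ... | inj₂ x = x
  ... | inj₁ (ae , naq) with ancestor-before he m ae e<q naq
  ... | a<q with scanned I m a<q
  ... | inj₁ p = ⊥-elim (stopped m a<q p)
  ... | inj₂ ne = ⊥-elim (ne ae l he)

  lastOf-unscanned : ∀ ps {q} → q ∈ ps → Unscanned (zmaxL ps) q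
  lastOf-unscanned ps m with zmaxL ps in eq
  ... | just x = proj₂ (zmaxL-just ps eq) m
  ... | nothing with zmaxL-nothing ps eq
  lastOf-unscanned .[] () | nothing | refl

  lastOf-occupied : ∀ c ps → (∀ {x} → x ∈ ps → x ∈ assigned c) → CursorOccupied (zmaxL ps) c
  lastOf-occupied c ps h with zmaxL ps in eq
  ... | just x = h (proj₁ (zmaxL-just ps eq))
  ... | nothing = tt

  prevOcc-occupied : ∀ c b → CursorOccupied (prevOcc c b) c
  prevOcc-occupied c b = lastOf-occupied c (filterB (λ q → lexLt q b) (assigned c)) (λ m → proj₁ (filterB-∈ _ (assigned c) m))

  prevOcc-unscanned : ∀ c b {q} → q ∈ assigned c → q ⊏ b → Unscanned (prevOcc c b) q
  prevOcc-unscanned c b m q⊏b =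
    lastOf-unscanned (filterB (λ q → lexLt q b) (assigned c)) (∈-filterB _ (assigned c) m (lexLt-complete q⊏b))

  refresh : Pixel → List Pixel → List Pixel
  refresh b′ S = b′ ∷ filterB (λ s → not ((s ==ᵖ b′) ∨ isChild b′ s)) S

  refresh-kept : ∀ b′ S {s} → s ∈ S → s ∈ refresh b′ S ⊎ b′ ⊑ s
  refresh-kept b′ S {s} m with (s ==ᵖ b′) in e₁ | isChild b′ s in e₂
  ... | true | _ = inj₂ (subst (b′ ⊑_) (sym (==-sound s b′ e₁)) ⊑-refl)
  ... | false | true = inj₂ (prefixB-sound b′ s (proj₁ (∧-true {prefixB b′ s} e₂)))
  ... | false | false = inj₁ (there (∈-filterB _ S m (cong not (both-false e₁ e₂))))
    where
    both-false : ∀ {x y} → x ≡ false → y ≡ false → (x ∨ y) ≡ false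
    both-false refl refl = refl

  -- One packing step: the square at the cursor b (after the target a) is moved
  -- to q₀, the z-first clear pixel of its layer inside a.
  module Packing {a b S c q₀} (I : InnerInv a (just b) S c) (a<b : a <z b)
                 (found : firstEmptyIn c a (length b) ≡ just q₀) where

    c₂ : Config
    c₂ = move c b q₀

    b′ : Pixel
    b′ = maxEmpty c₂ b

    a⊑q₀ : a ⊑ q₀
    a⊑q₀ = proj₁ (firstEmptyIn-just c a (length b) found)

    q₀-layer : length q₀ ≡ length b
    q₀-layer = proj₁ (proj₂ (firstEmptyIn-just c a (length b) found))

    q₀-clear : Clear c q₀
    q₀-clear = proj₁ (proj₂ (proj₂ (firstEmptyIn-just c a (length b) found)))

    q₀-first : ∀ {e} → a ⊑ e → length e ≡ length b → Clear c e → ¬ (e <z q₀)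
    q₀-first = proj₂ (proj₂ (proj₂ (firstEmptyIn-just c a (length b) found)))

    q₀-occupied : q₀ ∈ assigned c₂
    q₀-occupied = move-target c b q₀ (cursor I)

    -- The vacated pixel b is clear afterwards (b is outside a, q₀ inside a).
    b-clear : Clear c₂ b
    b-clear m n with move-∈ c b q₀ m
    b-clear m (inj₁ y) | inj₁ refl = <z-¬⊑ (<z-descʳ a<b y) a⊑q₀
    b-clear m (inj₂ y) | inj₁ refl = <z-¬⊑ a<b (⊑-trans a⊑q₀ y)
    ... | inj₂ (mx , ne) = antichain-unnested (antichain I) (cursor I) mx ne n

    b′-clear : Clear c₂ b′
    b′-clear = proj₁ (maxEmpty-top c₂ b b-clear ⊑-refl)

    b′⊑b : b′ ⊑ b
    b′⊑b = proj₂ (maxEmpty-top c₂ b b-clear ⊑-refl)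

    b′-top : ∀ {e} → Clear c₂ e → Nested e b → b′ ⊑ e
    b′-top he (inj₁ e⊑b) = proj₂ (maxEmpty-top c₂ b he e⊑b)
    b′-top he (inj₂ b⊑e) = ⊑-trans b′⊑b b⊑e

    b′-¬⊑-occupied : ∀ {q} → q ∈ assigned c₂ → ¬ (b′ ⊑ q)
    b′-¬⊑-occupied m b′⊑q = b′-clear m (inj₁ b′⊑q)

    -- Inside a, the move only filled pixels, so clear pixels were clear before.
    clear-inside-a : ∀ {e} → a ⊑ e → Clear c₂ e → Clear c e
    clear-inside-a {e} ae he with clear-after-move c b q₀ he
    ... | inj₁ x = x
    ... | inj₂ (inj₁ e⊑b) = ⊥-elim (<z-¬⊑ a<b (⊑-trans ae e⊑b))
    ... | inj₂ (inj₂ b⊑e) with ⊑-common ae b⊑e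
    ... | inj₁ a⊑b = ⊥-elim (<z-¬⊑ a<b a⊑b)
    ... | inj₂ b⊑a = ⊥-elim (<z-¬⊒ a<b b⊑a)

    a<b′ : a <z b′
    a<b′ = <z-ancestor a<b b′⊑b unnested
      where
      unnested : ¬ Nested a b′
      unnested (inj₁ a⊑b′) = <z-¬⊑ a<b (⊑-trans a⊑b′ b′⊑b)
      unnested (inj₂ b′⊑a) = b′-clear q₀-occupied (inj₁ (⊑-trans b′⊑a a⊑q₀))

    pending′ : ∀ {s} → s ∈ refresh b′ S → a ⊏ s
    pending′ (here refl) = inj₁ a<b′
    pending′ (there m) = pending I (proj₁ (filterB-∈ _ S m))

    scanned′ : ∀ {q} → q ∈ assigned c₂ → a <z q → Unscanned (prevOcc c₂ b) q ⊎ Unpackable c₂ a q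
    scanned′ m a<q with move-∈ c b q₀ m
    ... | inj₁ refl = ⊥-elim (<z-¬⊑ a<q a⊑q₀)
    ... | inj₂ (mq , q≢b) with scanned I mq a<q
    ... | inj₁ (inj₁ refl) = ⊥-elim (q≢b refl)
    ... | inj₁ (inj₂ q⊏b) = inj₁ (prevOcc-unscanned c₂ b (∈-move c b q₀ mq q≢b) q⊏b)
    ... | inj₂ ne = inj₂ (λ ae l he → ne ae l (clear-inside-a ae he))

    -- A violation against the moved square at q₀ would be against b before
    -- the move, but the witnesses of those lie after a, while e lies before a.
    no-violation-at-q₀ : ∀ {e} → Clear c₂ e → length e ≡ length q₀ → ¬ (e <z q₀)
    no-violation-at-q₀ {e} he l e<q₀ with position a e
    ... | ancestor ae = q₀-first ae (trans l q₀-layer) (clear-inside-a ae he) e<q₀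
    ... | descendant ea = he q₀-occupied (inj₁ (⊑-trans ea a⊑q₀))
    ... | before ae = <z-asym e<q₀ (<z-descˡ ae a⊑q₀)
    ... | after e<a = unwitnessed (violations I e-clear (cursor I) (trans l q₀-layer) (<z-trans e<a a<b))
      where
      e-clear : Clear c e
      e-clear with clear-after-move c b q₀ he
      ... | inj₁ x = x
      ... | inj₂ (inj₁ e⊑b) = ⊥-elim (<z-asym e<a (<z-ancestor a<b e⊑b (λ n → <z-¬nested e<a (nested-sym n))))
      ... | inj₂ (inj₂ b⊑e) = ⊥-elim (<z-asym e<a (<z-descʳ a<b b⊑e))
      unwitnessed : ¬ ((a ⊑ e × ¬ (a ⊑ b)) ⊎ (Σ Pixel λ s → s ∈ S × s ⊑ e × ¬ (s ⊑ b)))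
      unwitnessed (inj₁ (ae , _)) = <z-¬⊒ e<a ae
      unwitnessed (inj₂ (s , ms , se , _)) with pending I ms
      ... | inj₁ a<s = <z-asym e<a (<z-descʳ a<s se)
      ... | inj₂ (a⊑s , _) = <z-¬⊒ e<a (⊑-trans a⊑s se)

    -- Other violations existed before the move (and keep their witness, or
    -- one below b′), or involve a pixel nested with b and are witnessed by b′.
    violations′ : ∀ {e q} → Clear c₂ e → q ∈ assigned c₂ → length e ≡ length q → e <z q →
                    (a ⊑ e × ¬ (a ⊑ q)) ⊎ (Σ Pixel λ s → s ∈ refresh b′ S × s ⊑ e × ¬ (s ⊑ q))
    violations′ he m l e<q with move-∈ c b q₀ m
    ... | inj₁ refl = ⊥-elim (no-violation-at-q₀ he l e<q)
    ... | inj₂ (mq , _) with clear-after-move c b q₀ he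
    ... | inj₂ n = inj₂ (b′ , here refl , b′-top he n , b′-¬⊑-occupied m)
    ... | inj₁ hec with violations I hec mq l e<q
    ... | inj₁ x = inj₁ x
    ... | inj₂ (s , ms , se , s⋢q) with refresh-kept b′ S ms
    ... | inj₁ ms′ = inj₂ (s , ms′ , se , s⋢q)
    ... | inj₂ b′s = inj₂ (b′ , here refl , ⊑-trans b′s se , b′-¬⊑-occupied m)

    packed : InnerInv a (prevOcc c₂ b) (refresh b′ S) c₂
    packed = record
      { antichain = move-antichain c b q₀ (antichain I) q₀-clear
      ; violations = violations′
      ; scanned = scanned′
      ; pending = pending′
      ; cursor = prevOcc-occupied c₂ b
      }

  mutual
    outer-correct : ∀ n S c {c′} → Antichain (assigned c) → Witnessed S c → outer n S c ≡ just c′ → Result c c′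
    outer-correct zero S c w wit ()
    outer-correct (suc n) S c w wit h with zminL S in eq
    ... | nothing with zminL-nothing S eq
    outer-correct (suc n) .[] c w wit refl | nothing | refl =
      (λ he m l e<q → unwitnessed (wit he m l e<q)) , w , refl
      where
      unwitnessed : ∀ {e q} → ¬ (Σ Pixel λ s → s ∈ [] × s ⊑ e × ¬ (s ⊑ q))
      unwitnessed (_ , () , _)
    outer-correct (suc n) S c w wit h | just a = inner-correct n a (lastOcc c) S′ c start h
      where
      S′ = filterB (λ s → not (s ==ᵖ a)) S
      start : InnerInv a (lastOcc c) S′ c
      InnerInv.antichain start = w
      InnerInv.violations start he m l e<q with wit he m l e<q
      ... | s , ms , se , s⋢q with s ≟ᵖ a
      ... | yes refl = inj₁ (se , s⋢q)
      ... | no ne = inj₂ (s , ∈-filterB _ S ms (cong not (==-false ne)) , se , s⋢q)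
      InnerInv.scanned start m a<q = inj₁ (lastOf-unscanned (assigned c) m)
      InnerInv.pending start {s} m with filterB-∈ _ S m
      ... | ms , kept with proj₂ (zminL-just S eq) ms
      ... | inj₂ l = l
      ... | inj₁ refl rewrite ==-refl s = ⊥-elim (true≢false (sym kept))
      InnerInv.cursor start = lastOf-occupied c (assigned c) (λ m → m)

    inner-correct : ∀ n a mb S c {c′} → InnerInv a mb S c → inner n a mb S c ≡ just c′ → Result c c′
    inner-correct zero a mb S c I ()
    inner-correct (suc n) a nothing S c I h = outer-correct n S c (antichain I) (inner-exit I (λ _ _ ())) h
    inner-correct (suc n) a (just b) S c I h with zltB a b in z
    ... | false = outer-correct n S c (antichain I) (inner-exit I stopped) h
      where
      stopped : ∀ {q} → q ∈ assigned c → a <z q → ¬ Unscanned (just b) q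
      stopped m a<q (inj₁ refl) = true≢false (trans (sym (zltB-complete a<q)) z)
      stopped m a<q (inj₂ q⊏b) = true≢false (trans (sym (zltB-complete (<z-⊏ a<q q⊏b))) z)
    ... | true = pack-correct n a b S c (firstEmptyIn c a (length b)) I (zltB-sound a b z) refl h

    pack-correct : ∀ n a b S c mq {c′} → InnerInv a (just b) S c → a <z b → firstEmptyIn c a (length b) ≡ mq →
                   pack n a b S c mq ≡ just c′ → Result c c′
    pack-correct n a b S c nothing I a<b none h = inner-correct n a (prevOcc c b) S c skipped h
      where
      skipped : InnerInv a (prevOcc c b) S c
      InnerInv.antichain skipped = antichain I
      InnerInv.violations skipped = violations I
      InnerInv.pending skipped = pending I
      InnerInv.cursor skipped = prevOcc-occupied c b
      InnerInv.scanned skipped m a<q with scanned I m a<q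
      ... | inj₂ ne = inj₂ ne
      ... | inj₁ (inj₁ refl) = inj₂ (λ ae l he → firstEmptyIn-nothing c a (length b) none ae l he)
      ... | inj₁ (inj₂ q⊏b) = inj₁ (prevOcc-unscanned c b m q⊏b)
    pack-correct n a b S c (just q₀) I a<b found h with inner-correct n a _ _ _ (Packing.packed I a<b found) h
    ... | compact , w , same = compact , w , trans same (move-squares c b q₀ (Packing.q₀-layer I a<b found))

module DeletionTerminates where

  open Pixels
  open Decisions
  open Emptiness
  open Moves
  open DeletionCorrect using (refresh; CursorOccupied; prevOcc-occupied; lastOf-occupied)

  -- Every packing step moves a square
  -- to a pixel of its layer earlier in z-order, which strictly decreases the
  -- sum of the z-ranks of the occupied pixels.  Between two packing steps the
  -- loops decrease |S|·(|c|+3) (outer loop) resp. that quantity plus the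
  -- position of the cursor (inner loop).

  -- rank p is the index of p among the pixels of its layer in z-order.
  rank : Pixel → ℕ
  rank [] = 0
  rank (i ∷ p) = toℕ i * 4 ^ length p + rank p

  rank< : ∀ p → rank p < 4 ^ length p
  rank< [] = s≤s z≤n
  rank< (i ∷ p) = ℕP.≤-trans (ℕP.+-monoʳ-< (toℕ i * 4 ^ length p) (rank< p))
    (ℕP.≤-trans (ℕP.≤-reflexive (ℕP.+-comm (toℕ i * 4 ^ length p) (4 ^ length p)))
       (ℕP.*-monoˡ-≤ (4 ^ length p) (FP.toℕ<n i)))

  digit-dominates : ∀ x y K r s → x < y → r < K → x * K + r < y * K + s
  digit-dominates x y K r s x<y r<K = ℕP.≤-trans (ℕP.+-monoʳ-< (x * K) r<K)
    (ℕP.≤-trans (ℕP.≤-reflexive (ℕP.+-comm (x * K) K)) (ℕP.≤-trans (ℕP.*-monoˡ-≤ K x<y) (ℕP.m≤m+n (y * K) s)))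

  rank-mono : ∀ {p q} → length p ≡ length q → p <z q → rank p < rank q
  rank-mono {a ∷ p} {b ∷ q} l (z-here a<b) rewrite ℕP.suc-injective l =
    digit-dominates (toℕ a) (toℕ b) (4 ^ length q) (rank p) (rank q) a<b
      (subst (λ k → rank p < 4 ^ k) (ℕP.suc-injective l) (rank< p))
  rank-mono {a ∷ p} {.a ∷ q} l (z-there h) rewrite ℕP.suc-injective l =
    ℕP.+-monoʳ-< (toℕ a * 4 ^ length q) (rank-mono (ℕP.suc-injective l) h)

  rankSum : Config → ℕ
  rankSum c = sum (map rank (assigned c))

  move-rankSum≤ : ∀ c b q → rank q < rank b → rankSum (move c b q) ≤ rankSum c
  move-rankSum≤ [] b q lt = z≤n
  move-rankSum≤ ((i , p) ∷ c) b q lt with p ==ᵖ b in eq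
  ... | true rewrite ==-sound p b eq = ℕP.+-mono-≤ (ℕP.<⇒≤ lt) (move-rankSum≤ c b q lt)
  ... | false = ℕP.+-monoʳ-≤ (rank p) (move-rankSum≤ c b q lt)

  move-rankSum< : ∀ c b q → b ∈ assigned c → rank q < rank b → rankSum (move c b q) < rankSum c
  move-rankSum< ((i , p) ∷ c) b q m lt with p ==ᵖ b in eq
  ... | true rewrite ==-sound p b eq = ℕP.+-mono-<-≤ lt (move-rankSum≤ c b q lt)
  move-rankSum< ((i , p) ∷ c) b q (here refl) lt | false rewrite ==-refl p = ⊥-elim (true≢false eq)
  move-rankSum< ((i , p) ∷ c) b q (there m) lt | false = ℕP.+-monoʳ-< (rank p) (move-rankSum< c b q m lt)

  filterB-length : ∀ {A : Set} (f : A → Bool) xs → length (filterB f xs) ≤ length xs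
  filterB-length f [] = z≤n
  filterB-length f (y ∷ xs) with f y
  ... | true = s≤s (filterB-length f xs)
  ... | false = ℕP.m≤n⇒m≤1+n (filterB-length f xs)

  filterB-drops : ∀ {A : Set} (f : A → Bool) {x} xs → x ∈ xs → f x ≡ false → length (filterB f xs) < length xs
  filterB-drops f (y ∷ xs) (here refl) e rewrite e = s≤s (filterB-length f xs)
  filterB-drops f (y ∷ xs) (there m) e with f y
  ... | true = s≤s (filterB-drops f xs m e)
  ... | false = ℕP.m≤n⇒m≤1+n (filterB-drops f xs m e)

  filterB-stronger : ∀ {A : Set} (f g : A → Bool) xs → (∀ {x} → g x ≡ true → f x ≡ true) →
    length (filterB g xs) ≤ length (filterB f xs)
  filterB-stronger f g [] h = z≤n
  filterB-stronger f g (x ∷ xs) h with g x in eg | f x in ef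
  ... | true | true = s≤s (filterB-stronger f g xs h)
  ... | true | false = ⊥-elim (true≢false (trans (sym (h eg)) ef))
  ... | false | true = ℕP.m≤n⇒m≤1+n (filterB-stronger f g xs h)
  ... | false | false = filterB-stronger f g xs h

  filterB-stronger< : ∀ {A : Set} (f g : A → Bool) xs {y} → (∀ {x} → g x ≡ true → f x ≡ true) →
    y ∈ xs → f y ≡ true → g y ≡ false → length (filterB g xs) < length (filterB f xs)
  filterB-stronger< f g (x ∷ xs) h (here refl) fy gy rewrite fy | gy = s≤s (filterB-stronger f g xs h)
  filterB-stronger< f g (x ∷ xs) h (there m) fy gy with g x in eg | f x in ef
  ... | true | true = s≤s (filterB-stronger< f g xs h m fy gy)
  ... | true | false = ⊥-elim (true≢false (trans (sym (h eg)) ef))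
  ... | false | true = ℕP.m≤n⇒m≤1+n (filterB-stronger< f g xs h m fy gy)
  ... | false | false = filterB-stronger< f g xs h m fy gy

  cursorPos : Maybe Pixel → Config → ℕ
  cursorPos nothing c = 0
  cursorPos (just b) c = suc (length (filterB (λ q → lexLt q b) (assigned c)))

  cursorPos≤ : ∀ mb c → cursorPos mb c ≤ suc (length c)
  cursorPos≤ nothing c = z≤n
  cursorPos≤ (just b) c = s≤s (ℕP.≤-trans (filterB-length _ (assigned c)) (ℕP.≤-reflexive (LP.length-map proj₂ c)))

  cursorPos-prev : ∀ c b → cursorPos (prevOcc c b) c < cursorPos (just b) c
  cursorPos-prev c b with prevOcc c b in eq
  ... | nothing = s≤s z≤n
  ... | just b₂ with zmaxL-just _ eq
  ... | m , _ with filterB-∈ _ (assigned c) m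
  ... | m₂ , b₂⊏b = s≤s (filterB-stronger< (λ q → lexLt q b) (λ q → lexLt q b₂) (assigned c)
                           (λ {x} x⊏b₂ → lexLt-complete (⊏-trans (lexLt-sound x b₂ x⊏b₂) (lexLt-sound b₂ b b₂⊏b)))
                           m₂ b₂⊏b (lexLt-irrefl b₂))

  outerMeasure : List Pixel → Config → ℕ
  outerMeasure S c = length S * (length c + 3)

  innerMeasure : List Pixel → Maybe Pixel → Config → ℕ
  innerMeasure S mb c = outerMeasure S c + suc (cursorPos mb c)

  inner<outer : ∀ S S′ mb c → length S′ < length S → innerMeasure S′ mb c < outerMeasure S c
  inner<outer S S′ mb c lt =
    ℕP.≤-trans (s≤s (ℕP.+-monoʳ-≤ (length S′ * K) (s≤s (cursorPos≤ mb c))))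
      (ℕP.≤-trans (ℕP.≤-reflexive (one-more-block (length S′) (length c))) (ℕP.*-monoˡ-≤ K lt))
    where
    K = length c + 3
    one-more-block : ∀ s n → suc (s * (n + 3) + suc (suc n)) ≡ suc s * (n + 3)
    one-more-block = solve-∀

  outer<inner : ∀ S mb c → outerMeasure S c < innerMeasure S mb c
  outer<inner S mb c = ℕP.m<m+n (outerMeasure S c) (s≤s z≤n)

  outer-step : ∀ n S c a → zminL S ≡ just a →
    outer (suc n) S c ≡ inner n a (lastOcc c) (filterB (λ s → not (s ==ᵖ a)) S) c
  outer-step n S c a e rewrite e = refl

  outer-stop : ∀ n S c → zminL S ≡ nothing → outer (suc n) S c ≡ just c
  outer-stop n S c e rewrite e = refl

  inner-stop : ∀ n a b S c → zltB a b ≡ false → inner (suc n) a (just b) S c ≡ outer n S c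
  inner-stop n a b S c e rewrite e = refl

  inner-step : ∀ n a b S c → zltB a b ≡ true →
    inner (suc n) a (just b) S c ≡ pack n a b S c (firstEmptyIn c a (length b))
  inner-step n a b S c e rewrite e = refl

  Terminates : (ℕ → Maybe Config) → Set
  Terminates run = Σ ℕ λ n → Σ Config λ c′ → run n ≡ just c′

  -- Both loops terminate, by induction on the bounds P ≥ rankSum c and
  -- V ≥ the loop measure.
  mutual
    outer-terminates : ∀ P V S c → rankSum c ≤ P → outerMeasure S c ≤ V → Terminates (λ n → outer n S c)
    outer-terminates P V S c P-bound V-bound with zminL S in eq
    ... | nothing = 1 , c , outer-stop 0 S c eq
    ... | just a = enter V V-bound
      where
      S′ = filterB (λ s → not (s ==ᵖ a)) S
      decrease : innerMeasure S′ (lastOcc c) c < outerMeasure S c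
      decrease = inner<outer S S′ (lastOcc c) c (filterB-drops _ S (proj₁ (zminL-just S eq)) (cong not (==-refl a)))
      enter : ∀ V → outerMeasure S c ≤ V → Terminates (λ n → outer n S c)
      enter zero V-bound = ⊥-elim (ℕP.<⇒≱ decrease (ℕP.≤-trans V-bound z≤n))
      enter (suc V′) V-bound
        with inner-terminates P V′ a (lastOcc c) S′ c (lastOf-occupied c (assigned c) (λ m → m)) P-bound
               (ℕP.≤-pred (ℕP.≤-trans decrease V-bound))
      ... | n , c′ , h = suc n , c′ , trans (outer-step n S c a eq) h

    inner-terminates : ∀ P V a mb S c → CursorOccupied mb c → rankSum c ≤ P → innerMeasure S mb c ≤ V →
                       Terminates (λ n → inner n a mb S c)
    inner-terminates P zero a mb S c _ _ V-bound = ⊥-elim (ℕP.n≮0 (ℕP.<-≤-trans (outer<inner S mb c) V-bound))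
    inner-terminates P (suc V) a nothing S c _ P-bound V-bound
      with outer-terminates P V S c P-bound (ℕP.≤-pred (ℕP.≤-trans (outer<inner S nothing c) V-bound))
    ... | n , c′ , h = suc n , c′ , h
    inner-terminates P (suc V) a (just b) S c b-occ P-bound V-bound with zltB a b in z
    ... | false with outer-terminates P V S c P-bound (ℕP.≤-pred (ℕP.≤-trans (outer<inner S (just b) c) V-bound))
    ... | n , c′ , h = suc n , c′ , trans (inner-stop n a b S c z) h
    inner-terminates P (suc V) a (just b) S c b-occ P-bound V-bound | true with firstEmptyIn c a (length b) in found
    ... | nothing
      with inner-terminates P V a (prevOcc c b) S c (prevOcc-occupied c b) P-bound
             (ℕP.≤-pred (ℕP.≤-trans (ℕP.+-monoʳ-< (outerMeasure S c) (s≤s (cursorPos-prev c b))) V-bound))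
    ... | n , c′ , h = suc n , c′ , trans (inner-step n a b S c z) (trans (cong (pack n a b S c) found) h)
    inner-terminates P (suc V) a (just b) S c b-occ P-bound V-bound | true | just q₀ = packing P P-bound
      where
      q₀-spec = firstEmptyIn-just c a (length b) found
      c₂ = move c b q₀
      S₂ = refresh (maxEmpty c₂ b) S
      decrease : rankSum c₂ < rankSum c
      decrease = move-rankSum< c b q₀ b-occ
                   (rank-mono (proj₁ (proj₂ q₀-spec)) (<z-descˡ (zltB-sound a b z) (proj₁ q₀-spec)))
      packing : ∀ P → rankSum c ≤ P → Terminates (λ n → inner n a (just b) S c)
      packing zero P-bound = ⊥-elim (ℕP.<⇒≱ decrease (ℕP.≤-trans P-bound z≤n))
      packing (suc P′) P-bound
        with inner-terminates P′ (innerMeasure S₂ (prevOcc c₂ b) c₂) a (prevOcc c₂ b) S₂ c₂ (prevOcc-occupied c₂ b)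
               (ℕP.≤-pred (ℕP.≤-trans decrease P-bound)) ℕP.≤-refl
      ... | n , c′ , h = suc n , c′ , trans (inner-step n a b S c z) (trans (cong (pack n a b S c) found) h)

module Counting where

  open Pixels
  open Decisions
  open Emptiness

  Σ4 : (Fin 4 → ℕ) → ℕ
  Σ4 g = g 0F + (g 1F + (g 2F + g 3F))

  layerSum : (Pixel → ℕ) → ℕ → ℕ
  layerSum f zero = f []
  layerSum f (suc d) = Σ4 (λ i → layerSum (λ p → f (i ∷ p)) d)

  Σ4-cong : ∀ {f g} → (∀ i → f i ≡ g i) → Σ4 f ≡ Σ4 g
  Σ4-cong h rewrite h 0F | h 1F | h 2F | h 3F = refl

  Σ4-mono : ∀ {f g} → (∀ i → f i ≤ g i) → Σ4 f ≤ Σ4 g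
  Σ4-mono h = ℕP.+-mono-≤ (h 0F) (ℕP.+-mono-≤ (h 1F) (ℕP.+-mono-≤ (h 2F) (h 3F)))

  Σ4-one : ∀ g i → (∀ j → j ≢ i → g j ≡ 0) → Σ4 g ≡ g i
  Σ4-one g 0F h rewrite h 1F (λ ()) | h 2F (λ ()) | h 3F (λ ()) = ℕP.+-identityʳ (g 0F)
  Σ4-one g 1F h rewrite h 0F (λ ()) | h 2F (λ ()) | h 3F (λ ()) = ℕP.+-identityʳ (g 1F)
  Σ4-one g 2F h rewrite h 0F (λ ()) | h 1F (λ ()) | h 3F (λ ()) = ℕP.+-identityʳ (g 2F)
  Σ4-one g 3F h rewrite h 0F (λ ()) | h 1F (λ ()) | h 2F (λ ()) = refl

  Σ4-witness : ∀ g → 0 < Σ4 g → Σ (Fin 4) λ i → 0 < g i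
  Σ4-witness g h with g 0F in e₀ | g 1F in e₁ | g 2F in e₂ | g 3F in e₃
  ... | suc _ | _ | _ | _ = 0F , subst (0 <_) (sym e₀) (s≤s z≤n)
  ... | zero | suc _ | _ | _ = 1F , subst (0 <_) (sym e₁) (s≤s z≤n)
  ... | zero | zero | suc _ | _ = 2F , subst (0 <_) (sym e₂) (s≤s z≤n)
  ... | zero | zero | zero | suc _ = 3F , subst (0 <_) (sym e₃) (s≤s z≤n)
  ... | zero | zero | zero | zero = ⊥-elim (ℕP.n≮0 h)

  Σ4-single : ∀ B g → (∀ i → g i ≤ B) → (∀ {i j} → 0 < g i → 0 < g j → i ≡ j) → Σ4 g ≤ B
  Σ4-single B g bound one with Σ4 g in s
  ... | zero = z≤n
  ... | suc _ with Σ4-witness g (subst (0 <_) (sym s) (s≤s z≤n))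
  ... | i , gᵢ>0 = subst (_≤ B) (trans (sym (Σ4-one g i others)) s) (bound i)
    where
    others : ∀ j → j ≢ i → g j ≡ 0
    others j ne with g j in e
    ... | zero = refl
    ... | suc _ = ⊥-elim (ne (one (subst (0 <_) (sym e) (s≤s z≤n)) gᵢ>0))

  layerSum-ext : ∀ d {f g} → (∀ Q → length Q ≡ d → f Q ≡ g Q) → layerSum f d ≡ layerSum g d
  layerSum-ext zero h = h [] refl
  layerSum-ext (suc d) h = Σ4-cong (λ i → layerSum-ext d (λ Q l → h (i ∷ Q) (cong suc l)))

  layerSum-mono : ∀ d {f g} → (∀ Q → length Q ≡ d → f Q ≤ g Q) → layerSum f d ≤ layerSum g d
  layerSum-mono zero h = h [] refl
  layerSum-mono (suc d) h = Σ4-mono (λ i → layerSum-mono d (λ Q l → h (i ∷ Q) (cong suc l)))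

  layerSum-+ : ∀ d f g → layerSum (λ Q → f Q + g Q) d ≡ layerSum f d + layerSum g d
  layerSum-+ zero f g = refl
  layerSum-+ (suc d) f g =
    trans (Σ4-cong (λ i → layerSum-+ d (λ p → f (i ∷ p)) (λ p → g (i ∷ p))))
          (interchange (part 0F f) (part 1F f) (part 2F f) (part 3F f) (part 0F g) (part 1F g) (part 2F g) (part 3F g))
    where
    part : Fin 4 → (Pixel → ℕ) → ℕ
    part i h = layerSum (λ p → h (i ∷ p)) d
    interchange : ∀ a b c d a′ b′ c′ d′ →
      (a + a′) + ((b + b′) + ((c + c′) + (d + d′))) ≡ (a + (b + (c + d))) + (a′ + (b′ + (c′ + d′)))
    interchange = solve-∀

  layerSum-* : ∀ d k f → layerSum (λ Q → k * f Q) d ≡ k * layerSum f d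
  layerSum-* zero k f = refl
  layerSum-* (suc d) k f =
    trans (Σ4-cong (λ i → layerSum-* d k (λ p → f (i ∷ p)))) (distrib k (part 0F) (part 1F) (part 2F) (part 3F))
    where
    part : Fin 4 → ℕ
    part i = layerSum (λ p → f (i ∷ p)) d
    distrib : ∀ k a b c d → k * a + (k * b + (k * c + k * d)) ≡ k * (a + (b + (c + d)))
    distrib = solve-∀

  layerSum-0 : ∀ d → layerSum (λ _ → 0) d ≡ 0
  layerSum-0 zero = refl
  layerSum-0 (suc d) rewrite layerSum-0 d = refl

  layerSum-1 : ∀ d → layerSum (λ _ → 1) d ≡ 4 ^ d
  layerSum-1 zero = refl
  layerSum-1 (suc d) rewrite layerSum-1 d = four-times (4 ^ d)
    where
    four-times : ∀ x → x + (x + (x + x)) ≡ 4 * x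
    four-times = solve-∀

  layerSum-children : ∀ d f → layerSum f (suc d) ≡ layerSum (λ Q → Σ4 (λ i → f (Q ++ (i ∷ [])))) d
  layerSum-children zero f = refl
  layerSum-children (suc d) f = Σ4-cong (λ i → layerSum-children d (λ p → f (i ∷ p)))

  layerSum-witness : ∀ d f → 0 < layerSum f d → Σ Pixel λ Q → length Q ≡ d × 0 < f Q
  layerSum-witness zero f h = [] , refl , h
  layerSum-witness (suc d) f h with Σ4-witness _ h
  ... | i , hᵢ with layerSum-witness d (λ p → f (i ∷ p)) hᵢ
  ... | Q , l , fQ = i ∷ Q , cong suc l , fQ

  layerSum-single : ∀ B d f → (∀ Q → f Q ≤ B) →
    (∀ Q Q′ → length Q ≡ d → length Q′ ≡ d → 0 < f Q → 0 < f Q′ → Q ≡ Q′) → layerSum f d ≤ B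
  layerSum-single B zero f bound one = bound []
  layerSum-single B (suc d) f bound one = Σ4-single B _ child-bound child-one
    where
    child-bound : ∀ i → layerSum (λ p → f (i ∷ p)) d ≤ B
    child-bound i = layerSum-single B d (λ p → f (i ∷ p)) (λ Q → bound (i ∷ Q))
      (λ Q Q′ l l′ h h′ → LP.∷-injectiveʳ (one (i ∷ Q) (i ∷ Q′) (cong suc l) (cong suc l′) h h′))
    child-one : ∀ {i j} → 0 < layerSum (λ p → f (i ∷ p)) d → 0 < layerSum (λ p → f (j ∷ p)) d → i ≡ j
    child-one {i} {j} hᵢ hⱼ with layerSum-witness d _ hᵢ | layerSum-witness d _ hⱼ
    ... | Q , l , fQ | Q′ , l′ , fQ′ = LP.∷-injectiveˡ (one (i ∷ Q) (j ∷ Q′) (cong suc l) (cong suc l′) fQ fQ′)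

module ClearCount where

  open Pixels
  open Decisions
  open Emptiness
  open Counting

  -- Counting argument for insertions: in a compact configuration, the number
  -- E(d) of clear pixels of layer d satisfies E(d+1) ≤ 4·E(d) + 3, since the
  -- children of clear pixels are clear and at most one non-clear pixel per
  -- layer has clear children.

  clear# : Config → Pixel → ℕ
  clear# c Q = if isEmptyB c Q then 1 else 0

  covered# : Config → Pixel → ℕ
  covered# c Q = if isEmptyB c Q then 0 else 1

  clear#+covered# : ∀ c Q → clear# c Q + covered# c Q ≡ 1
  clear#+covered# c Q with isEmptyB c Q
  ... | true = refl
  ... | false = refl

  clear#≤1 : ∀ c Q → clear# c Q ≤ 1
  clear#≤1 c Q with isEmptyB c Q
  ... | true = s≤s z≤n
  ... | false = z≤n

  clear#-unclear : ∀ c Q → ¬ Clear c Q → clear# c Q ≡ 0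
  clear#-unclear c Q ne rewrite isEmptyB-false c Q ne = refl

  child : Pixel → Fin 4 → Pixel
  child Q i = Q ++ (i ∷ [])

  frontier : Config → Pixel → ℕ
  frontier c Q = if isEmptyB c Q then 0 else Σ4 (λ i → clear# c (child Q i))

  clear-child : ∀ c Q → isEmptyB c Q ≡ true → ∀ i → isEmptyB c (child Q i) ≡ true
  clear-child c Q e i = isEmptyB-complete c _ (Clear-desc (isEmptyB-sound c Q e) (⊑-++ Q (i ∷ [])))

  children-clear# : ∀ c Q → Σ4 (λ i → clear# c (child Q i)) ≡ 4 * clear# c Q + frontier c Q
  children-clear# c Q with isEmptyB c Q in e
  ... | false = refl
  ... | true rewrite clear-child c Q e 0F | clear-child c Q e 1F | clear-child c Q e 2F | clear-child c Q e 3F = refl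

  ⊑-child : ∀ Q j r → child Q j ⊑ Q ++ (j ∷ r)
  ⊑-child [] j r = child⊑ root⊑
  ⊑-child (a ∷ Q) j r = child⊑ (⊑-child Q j r)

  unclear-child : ∀ c Q {x} → x ∈ assigned c → Nested Q x → Σ (Fin 4) λ j → ¬ Clear c (child Q j)
  unclear-child c Q m (inj₂ x⊑Q) = 0F , λ h → h m (inj₂ (⊑-trans x⊑Q (⊑-++ Q _)))
  unclear-child c Q m (inj₁ Q⊑x) with ⊑⇒≼ Q⊑x
  ... | [] , refl = 0F , λ h → h m (inj₂ (subst (_⊑ child Q 0F) (sym (LP.++-identityʳ Q)) (⊑-++ Q _)))
  ... | (j ∷ r) , refl = j , λ h → h m (inj₁ (⊑-child Q j r))

  Σ4-hole : ∀ g j → (∀ i → g i ≤ 1) → g j ≡ 0 → Σ4 g ≤ 3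
  Σ4-hole g 0F b z = ℕP.+-mono-≤ (ℕP.≤-reflexive z) (ℕP.+-mono-≤ (b 1F) (ℕP.+-mono-≤ (b 2F) (b 3F)))
  Σ4-hole g 1F b z = ℕP.+-mono-≤ (b 0F) (ℕP.+-mono-≤ (ℕP.≤-reflexive z) (ℕP.+-mono-≤ (b 2F) (b 3F)))
  Σ4-hole g 2F b z = ℕP.+-mono-≤ (b 0F) (ℕP.+-mono-≤ (b 1F) (ℕP.+-mono-≤ (ℕP.≤-reflexive z) (b 3F)))
  Σ4-hole g 3F b z = ℕP.+-mono-≤ (b 0F) (ℕP.+-mono-≤ (b 1F) (ℕP.+-mono-≤ (b 2F) (ℕP.≤-reflexive z)))

  -- A non-clear pixel has a non-clear child, so its frontier is at most 3.
  frontier≤3 : ∀ c Q → frontier c Q ≤ 3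
  frontier≤3 c Q with isEmptyB c Q in e
  ... | true = z≤n
  ... | false with not-clear-witness c Q e
  ... | x , m , n with unclear-child c Q m n
  ... | j , unclear = Σ4-hole (λ i → clear# c (child Q i)) j (λ i → clear#≤1 c (child Q i)) (clear#-unclear c _ unclear)

  frontier-positive : ∀ c Q → 0 < frontier c Q → isEmptyB c Q ≡ false × Σ (Fin 4) λ i → Clear c (child Q i)
  frontier-positive c Q h with isEmptyB c Q in e
  frontier-positive c Q () | true
  ... | false with Σ4-witness _ h
  ... | i , hᵢ = refl , i , isEmptyB-sound c _ (counted hᵢ)
    where
    counted : 0 < clear# c (child Q i) → isEmptyB c (child Q i) ≡ true
    counted h with isEmptyB c (child Q i)
    ... | true = refl
    counted () | false

  -- In a compact configuration, if Q precedes Q′ on a layer and Q has a clear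
  -- child, then a non-clear Q′ has no clear child: padding Q's clear child
  -- down to the layer of an occupied pixel below Q′ would violate compactness.
  frontier-ordered : ∀ c → Compact c → ∀ {Q Q′ i j} → length Q ≡ length Q′ → Q <z Q′ →
    Clear c (child Q i) → isEmptyB c Q′ ≡ false → ¬ Clear c (child Q′ j)
  frontier-ordered c compact {Q} {Q′} {i} {j} l Q<Q′ clearQ unclear clearQ′ with not-clear-witness c Q′ unclear
  ... | x , m , inj₂ x⊑Q′ = clearQ′ m (inj₂ (⊑-trans x⊑Q′ (⊑-++ Q′ _)))
  ... | x , m , inj₁ Q′⊑x with ⊑⇒≼ Q′⊑x
  ... | [] , refl = clearQ′ m (inj₂ (subst (_⊑ child Q′ j) (sym (LP.++-identityʳ Q′)) (⊑-++ Q′ _)))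
  ... | (k ∷ r) , refl = compact (Clear-desc clearQ (⊑-++ _ _)) m padded-layer padded-before
    where
    padded : Pixel
    padded = child Q i ++ replicate (length r) 0F
    padded-layer : length padded ≡ length (Q′ ++ (k ∷ r))
    padded-layer = begin
      length (child Q i ++ replicate (length r) 0F)  ≡⟨ LP.length-++ (child Q i) ⟩
      length (child Q i) + length (replicate (length r) 0F)
        ≡⟨ cong₂ _+_ (trans (LP.length-++ Q) (trans (ℕP.+-comm (length Q) 1) (cong suc l))) (LP.length-replicate (length r)) ⟩
      suc (length Q′) + length r  ≡⟨ sym (ℕP.+-suc (length Q′) (length r)) ⟩
      length Q′ + length (k ∷ r)  ≡⟨ sym (LP.length-++ Q′) ⟩
      length (Q′ ++ (k ∷ r))      ∎
      where open ≡-Reasoning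
    padded-before : padded <z (Q′ ++ (k ∷ r))
    padded-before = <z-descʳ (<z-descˡ Q<Q′ (⊑-trans (⊑-++ Q _) (⊑-++ _ _))) (⊑-++ Q′ _)

  frontier-unique : ∀ c → Compact c → ∀ d Q Q′ → length Q ≡ d → length Q′ ≡ d →
    0 < frontier c Q → 0 < frontier c Q′ → Q ≡ Q′
  frontier-unique c compact d Q Q′ l l′ h h′ with Q ≟ᵖ Q′
  ... | yes e = e
  ... | no ne with frontier-positive c Q h | frontier-positive c Q′ h′ | same-layer-<z Q Q′ (trans l (sym l′)) ne
  ... | (_ , i , clearQ) | (unclear′ , j , clearQ′) | inj₁ Q<Q′ =
    ⊥-elim (frontier-ordered c compact (trans l (sym l′)) Q<Q′ clearQ unclear′ clearQ′)
  ... | (unclear , i , clearQ) | (_ , j , clearQ′) | inj₂ Q′<Q =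
    ⊥-elim (frontier-ordered c compact (trans l′ (sym l)) Q′<Q clearQ′ unclear clearQ)

  clear-growth : ∀ c → Compact c → ∀ d → layerSum (clear# c) (suc d) ≤ 4 * layerSum (clear# c) d + 3
  clear-growth c compact d = begin
    layerSum (clear# c) (suc d)                                   ≡⟨ layerSum-children d (clear# c) ⟩
    layerSum (λ Q → Σ4 (λ i → clear# c (child Q i))) d              ≡⟨ layerSum-ext d (λ Q _ → children-clear# c Q) ⟩
    layerSum (λ Q → 4 * clear# c Q + frontier c Q) d               ≡⟨ layerSum-+ d (λ Q → 4 * clear# c Q) (frontier c) ⟩
    layerSum (λ Q → 4 * clear# c Q) d + layerSum (frontier c) d    ≡⟨ cong (_+ layerSum (frontier c) d) (layerSum-* d 4 (clear# c)) ⟩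
    4 * layerSum (clear# c) d + layerSum (frontier c) d
      ≤⟨ ℕP.+-monoʳ-≤ (4 * layerSum (clear# c) d) (layerSum-single 3 d (frontier c) (frontier≤3 c) (frontier-unique c compact d)) ⟩
    4 * layerSum (clear# c) d + 3                                  ∎
    where open ℕP.≤-Reasoning

  clear-bound : ∀ c → Compact c → ∀ ℓ → (∀ Q → length Q ≡ ℓ → ¬ Clear c Q) →
    ∀ k → layerSum (clear# c) (k + ℓ) + 1 ≤ 4 ^ k
  clear-bound c compact ℓ none zero =
    subst (λ w → w + 1 ≤ 1) (sym (trans (layerSum-ext ℓ (λ Q l → clear#-unclear c Q (none Q l))) (layerSum-0 ℓ))) ℕP.≤-refl
  clear-bound c compact ℓ none (suc k) = begin
    layerSum (clear# c) (suc (k + ℓ)) + 1    ≤⟨ ℕP.+-monoˡ-≤ 1 (clear-growth c compact (k + ℓ)) ⟩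
    4 * layerSum (clear# c) (k + ℓ) + 3 + 1  ≡⟨ four-times-plus-one (layerSum (clear# c) (k + ℓ)) ⟩
    4 * (layerSum (clear# c) (k + ℓ) + 1)    ≤⟨ ℕP.*-monoʳ-≤ 4 (clear-bound c compact ℓ none k) ⟩
    4 * 4 ^ k                                ∎
    where
    open ℕP.≤-Reasoning
    four-times-plus-one : ∀ x → 4 * x + 3 + 1 ≡ 4 * (x + 1)
    four-times-plus-one = solve-∀

  -- Counting covered pixels: on a layer D below every occupied pixel, a covered
  -- pixel lies below some occupied x, and x has 4^(D − layer x) descendants on
  -- layer D.

  below# : Pixel → Pixel → ℕ
  below# x Q = if prefixB x Q then 1 else 0

  sum-∈ : ∀ {A : Set} (f : A → ℕ) {y} xs → y ∈ xs → f y ≤ sum (map f xs)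
  sum-∈ f (x ∷ xs) (here refl) = ℕP.m≤m+n (f x) _
  sum-∈ f (x ∷ xs) (there m) = ℕP.≤-trans (sum-∈ f xs m) (ℕP.m≤n+m _ (f x))

  sum-cong∈ : ∀ {A : Set} {f g : A → ℕ} xs → (∀ {x} → x ∈ xs → f x ≡ g x) → sum (map f xs) ≡ sum (map g xs)
  sum-cong∈ [] h = refl
  sum-cong∈ (x ∷ xs) h = cong₂ _+_ (h (here refl)) (sum-cong∈ xs (λ m → h (there m)))

  covered#≤below# : ∀ c D Q → length Q ≡ D → (∀ {x} → x ∈ assigned c → length x ≤ D) →
    covered# c Q ≤ sum (map (λ x → below# x Q) (assigned c))
  covered#≤below# c D Q l deep with isEmptyB c Q in e
  ... | true = z≤n
  ... | false with not-clear-witness c Q e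
  ... | x , m , n = ℕP.≤-trans (ℕP.≤-reflexive (sym (counted (x⊑Q n)))) (sum-∈ (λ x → below# x Q) (assigned c) m)
    where
    x⊑Q : Nested Q x → x ⊑ Q
    x⊑Q (inj₂ y) = y
    x⊑Q (inj₁ y) = subst (_⊑ Q) (⊑-same-layer y (ℕP.≤-antisym (⊑-layer y) (subst (length x ≤_) (sym l) (deep m)))) ⊑-refl
    counted : x ⊑ Q → below# x Q ≡ 1
    counted h rewrite prefixB-complete h = refl

  layerSum-sum : ∀ d xs → layerSum (λ Q → sum (map (λ x → below# x Q) xs)) d ≡ sum (map (λ x → layerSum (below# x) d) xs)
  layerSum-sum d [] = layerSum-0 d
  layerSum-sum d (x ∷ xs) =
    trans (layerSum-+ d (below# x) (λ Q → sum (map (λ x → below# x Q) xs))) (cong (layerSum (below# x) d +_) (layerSum-sum d xs))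

  below#-other-child : ∀ i j x Q → j ≢ i → below# (i ∷ x) (j ∷ Q) ≡ 0
  below#-other-child i j x Q ne with i FP.≟ j
  ... | yes refl = ⊥-elim (ne refl)
  ... | no _ = refl

  below#-same-child : ∀ i x Q → below# (i ∷ x) (i ∷ Q) ≡ below# x Q
  below#-same-child i x Q with i FP.≟ i
  ... | yes _ = refl
  ... | no ne = ⊥-elim (ne refl)

  descendants : ∀ x D → length x ≤ D → layerSum (below# x) D ≡ 4 ^ (D ∸ length x)
  descendants [] D le = layerSum-1 D
  descendants (i ∷ x) (suc D) (s≤s le) =
    trans (Σ4-one _ i (λ j ne → trans (layerSum-ext D (λ Q _ → below#-other-child i j x Q ne)) (layerSum-0 D)))
          (trans (layerSum-ext D (λ Q _ → below#-same-child i x Q)) (descendants x D le))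

  no-clear-pixel-bound : ∀ c → Compact c → ∀ ℓ k → (∀ Q → length Q ≡ ℓ → ¬ Clear c Q) →
    (∀ {x} → x ∈ assigned c → length x ≤ k + ℓ) →
    4 ^ (k + ℓ) + 1 ≤ sum (map (λ x → 4 ^ ((k + ℓ) ∸ length x)) (assigned c)) + 4 ^ k
  no-clear-pixel-bound c compact ℓ k none deep = begin
    4 ^ D + 1          ≡⟨ cong (_+ 1) all-pixels ⟩
    clear + covered + 1 ≡⟨ rearrange clear covered ⟩
    covered + (clear + 1) ≤⟨ ℕP.+-mono-≤ covered≤N (clear-bound c compact ℓ none k) ⟩
    N + 4 ^ k          ∎
    where
    open ℕP.≤-Reasoning
    D = k + ℓ
    clear = layerSum (clear# c) D
    covered = layerSum (covered# c) D
    N = sum (map (λ x → 4 ^ (D ∸ length x)) (assigned c))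
    all-pixels : 4 ^ D ≡ clear + covered
    all-pixels = trans (sym (layerSum-1 D)) (trans (layerSum-ext D (λ Q _ → sym (clear#+covered# c Q))) (layerSum-+ D (clear# c) (covered# c)))
    covered≤N : covered ≤ N
    covered≤N = ℕP.≤-trans (layerSum-mono D (λ Q l → covered#≤below# c D Q l deep))
                  (ℕP.≤-reflexive (trans (layerSum-sum D (assigned c)) (sum-cong∈ (assigned c) (λ {x} m → descendants x D (deep m)))))
    rearrange : ∀ e c → e + c + 1 ≡ c + (e + 1)
    rearrange = solve-∀

module Volume where

  open import Data.Integer using (+_)

  -- An ℓ-square has volume 4^-ℓ; against the common denominator
  -- 4^D (D at least every layer involved) it has volume 4^(D−ℓ)/4^D, which
  -- turns the rational validity condition into an inequality of naturals.

  volume : List ℕ → ℚ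
  volume ls = sumℚ (map volOf ls)

  module CommonDenominator (D K : ℕ) (4^D≡1+K : 4 ^ D ≡ suc K) where

    -- n / 4^D
    over4^D : ℕ → ℚᵘ.ℚᵘ
    over4^D n = mkℚᵘ (+ n) K

    unit-fraction : ∀ (p : ℚ) (g : ℤ) l → l ≤ D → ↥ p ℤ.* g ≡ + 1 → ↧ p ℤ.* g ≡ + (4 ^ l) →
      toℚᵘ p ℚᵘ.≃ over4^D (4 ^ (D ∸ l))
    unit-fraction p@(ℚ.mkℚ _ _ _) g l l≤D num den = ℚᵘ.*≡* cross
      where
      a = 4 ^ (D ∸ l)
      denominator : + suc K ≡ (↧ p ℤ.* g) ℤ.* + a
      denominator = begin
        + suc K              ≡⟨ cong +_ (sym 4^D≡1+K) ⟩
        + (4 ^ D)            ≡⟨ cong (λ k → + (4 ^ k)) (sym (ℕP.m+[n∸m]≡n l≤D)) ⟩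
        + (4 ^ (l + (D ∸ l))) ≡⟨ cong +_ (ℕP.^-distribˡ-+-* 4 l (D ∸ l)) ⟩
        + (4 ^ l * a)        ≡⟨ ℤP.pos-* (4 ^ l) a ⟩
        + (4 ^ l) ℤ.* + a    ≡⟨ cong (ℤ._* + a) (sym den) ⟩
        (↧ p ℤ.* g) ℤ.* + a  ∎
        where open ≡-Reasoning
      regroup : ∀ x y z w → x ℤ.* ((y ℤ.* z) ℤ.* w) ≡ (x ℤ.* z) ℤ.* (w ℤ.* y)
      regroup = ℤSolver.solve-∀
      cross : ↥ p ℤ.* + suc K ≡ + a ℤ.* ↧ p
      cross = begin
        ↥ p ℤ.* + suc K                ≡⟨ cong (↥ p ℤ.*_) denominator ⟩
        ↥ p ℤ.* ((↧ p ℤ.* g) ℤ.* + a)  ≡⟨ regroup (↥ p) (↧ p) g (+ a) ⟩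
        (↥ p ℤ.* g) ℤ.* (+ a ℤ.* ↧ p)  ≡⟨ cong (ℤ._* (+ a ℤ.* ↧ p)) num ⟩
        + 1 ℤ.* (+ a ℤ.* ↧ p)          ≡⟨ ℤP.*-identityˡ _ ⟩
        + a ℤ.* ↧ p                    ∎
        where open ≡-Reasoning

    volOf-over4^D : ∀ l → l ≤ D → toℚᵘ (volOf l) ℚᵘ.≃ over4^D (4 ^ (D ∸ l))
    volOf-over4^D l l≤D = unit-fraction (volOf l) (ℤGCD.gcd (+ 1) (+ (4 ^ l))) l l≤D
      (ℚP.↥-normalize 1 (4 ^ l) {{ℕP.m^n≢0 4 l}}) (ℚP.↧-normalize 1 (4 ^ l) {{ℕP.m^n≢0 4 l}})

    over4^D-+ : ∀ a b → (over4^D a ℚᵘ.+ over4^D b) ℚᵘ.≃ over4^D (a + b)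
    over4^D-+ a b = ℚᵘ.*≡* (trans (regroup (+ a) (+ b) (+ suc K)) (cong (ℤ._* (+ suc K ℤ.* + suc K)) (sym (ℤP.pos-+ a b))))
      where
      regroup : ∀ x y k → (x ℤ.* k ℤ.+ y ℤ.* k) ℤ.* k ≡ (x ℤ.+ y) ℤ.* (k ℤ.* k)
      regroup = ℤSolver.solve-∀

    volume-over4^D : ∀ ls → (∀ {l} → l ∈ ls → l ≤ D) →
      toℚᵘ (volume ls) ℚᵘ.≃ over4^D (sum (map (λ l → 4 ^ (D ∸ l)) ls))
    volume-over4^D [] deep = ℚᵘ.*≡* refl
    volume-over4^D (l ∷ ls) deep =
      ℚᵘP.≃-trans (ℚP.toℚᵘ-homo-+ (volOf l) (volume ls))
        (ℚᵘP.≃-trans (ℚᵘP.+-cong (volOf-over4^D l (deep (here refl))) (volume-over4^D ls (λ m → deep (there m))))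
          (over4^D-+ (4 ^ (D ∸ l)) (sum (map (λ l → 4 ^ (D ∸ l)) ls))))

    over4^D≤1 : ∀ n → over4^D n ℚᵘ.≤ toℚᵘ 1ℚ → n ≤ suc K
    over4^D≤1 n (ℚᵘ.*≤* le) =
      ℤP.drop‿+≤+ (subst₂ ℤ._≤_ (ℤP.*-identityʳ (+ n)) (ℤP.*-identityˡ (+ suc K)) le)

  volume-bound : ∀ D ℓ ls → ℓ ≤ D → (∀ {l} → l ∈ ls → l ≤ D) → (volume ls ℚ.+ volOf ℓ) ℚ.≤ 1ℚ →
    sum (map (λ l → 4 ^ (D ∸ l)) ls) + 4 ^ (D ∸ ℓ) ≤ 4 ^ D
  volume-bound D ℓ ls ℓ≤D deep fits = subst (N + 4 ^ (D ∸ ℓ) ≤_) (sym 4^D≡1+K) (over4^D≤1 (N + 4 ^ (D ∸ ℓ)) scaled)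
    where
    4^D≡1+K : 4 ^ D ≡ suc (4 ^ D ∸ 1)
    4^D≡1+K = sym (ℕP.m+[n∸m]≡n {1} {4 ^ D} (ℕP.m^n>0 4 D))
    open CommonDenominator D (4 ^ D ∸ 1) 4^D≡1+K
    N = sum (map (λ l → 4 ^ (D ∸ l)) ls)
    total : toℚᵘ (volume ls ℚ.+ volOf ℓ) ℚᵘ.≃ over4^D (N + 4 ^ (D ∸ ℓ))
    total = ℚᵘP.≃-trans (ℚP.toℚᵘ-homo-+ (volume ls) (volOf ℓ))
              (ℚᵘP.≃-trans (ℚᵘP.+-cong (volume-over4^D ls deep) (volOf-over4^D ℓ ℓ≤D)) (over4^D-+ N (4 ^ (D ∸ ℓ))))
    scaled = ℚᵘP.≤-respˡ-≃ total (ℚP.toℚᵘ-mono-≤ fits)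

module Requests where

  open Decisions using (true≢false)
  open Volume

  DistinctIds : List (ℕ × ℕ) → Set
  DistinctIds [] = ⊤
  DistinctIds (e ∷ s) = proj₁ e ∉ map proj₁ s × DistinctIds s

  area : List (ℕ × ℕ) → ℚ
  area s = volume (map proj₂ s)

  ≡ᵇ-true : ∀ {m n} → (m ≡ᵇ n) ≡ true → m ≡ n
  ≡ᵇ-true {m} {n} e = ℕP.≡ᵇ⇒≡ m n (subst T (sym e) tt)

  ≡ᵇ-false : ∀ {m n} → m ≢ n → (m ≡ᵇ n) ≡ false
  ≡ᵇ-false {m} {n} ne with m ≡ᵇ n in e
  ... | true = ⊥-elim (ne (≡ᵇ-true e))
  ... | false = refl

  ≡ᵇ-refl : ∀ n → (n ≡ᵇ n) ≡ true
  ≡ᵇ-refl zero = refl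
  ≡ᵇ-refl (suc n) = ≡ᵇ-refl n

  ids-filterB : ∀ {A : Set} (f : ℕ × A → Bool) s {y} → y ∈ map proj₁ (filterB f s) → y ∈ map proj₁ s
  ids-filterB f (e ∷ s) m with f e
  ids-filterB f (e ∷ s) (here refl) | true = here refl
  ids-filterB f (e ∷ s) (there m) | true = there (ids-filterB f s m)
  ... | false = there (ids-filterB f s m)

  filterB-absent : ∀ {A : Set} x (s : List (ℕ × A)) → x ∉ map proj₁ s → filterB (λ e → not (proj₁ e ≡ᵇ x)) s ≡ s
  filterB-absent x [] h = refl
  filterB-absent x ((y , l) ∷ s) h rewrite ≡ᵇ-false {y} {x} (λ e → h (here (sym e))) =
    cong ((y , l) ∷_) (filterB-absent x s (λ m → h (there m)))

  DistinctIds-filterB : ∀ (f : ℕ × ℕ → Bool) s → DistinctIds s → DistinctIds (filterB f s)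
  DistinctIds-filterB f [] u = tt
  DistinctIds-filterB f (e ∷ s) (n , u) with f e
  ... | true = (λ m → n (ids-filterB f s m)) , DistinctIds-filterB f s u
  ... | false = DistinctIds-filterB f s u

  DistinctIds-step : ∀ s r → DistinctIds s → Admissible s r → DistinctIds (applyReq s r)
  DistinctIds-step s (insert x ℓ) u a = a , u
  DistinctIds-step s (delete x) u a = DistinctIds-filterB _ s u

  delete-area : ∀ s x → DistinctIds s → x ∈ map proj₁ s →
    Σ ℕ λ l → lookupLayer s x ≡ just l × area s ≡ volOf l ℚ.+ area (filterB (λ e → not (proj₁ e ≡ᵇ x)) s)
  delete-area ((y , l′) ∷ s) x (n , u) m with y ≡ᵇ x in e
  ... | true rewrite ≡ᵇ-true {y} {x} e = l′ , refl , cong (volOf l′ ℚ.+_) (sym (cong area (filterB-absent x s n)))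
  delete-area ((y , l′) ∷ s) .y (n , u) (here refl) | false = ⊥-elim (true≢false (trans (sym (≡ᵇ-refl y)) e))
  delete-area ((y , l′) ∷ s) x (n , u) (there m) | false with delete-area s x u m
  ... | l , found , split = l , found , trans (cong (volOf l′ ℚ.+_) split) (swap (volOf l′) (volOf l) _)
    where
    swap : ∀ (a b c : ℚ) → a ℚ.+ (b ℚ.+ c) ≡ b ℚ.+ (a ℚ.+ c)
    swap a b c = trans (sym (ℚP.+-assoc a b c)) (trans (cong (ℚ._+ c) (ℚP.+-comm a b)) (ℚP.+-assoc b a c))

  step-area : ∀ s r → DistinctIds s → Admissible s r → area s ℚ.+ vol s r ≡ area (applyReq s r)
  step-area s (insert x ℓ) u a = ℚP.+-comm (area s) (volOf ℓ)
  step-area s (delete x) u a with delete-area s x u a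
  ... | l , found , split rewrite found = trans (cong (ℚ._+ ℚ.- volOf l) split) (cancel (volOf l) _)
    where
    cancel : ∀ (v F : ℚ) → (v ℚ.+ F) ℚ.+ ℚ.- v ≡ F
    cancel v F = trans (cong (ℚ._+ ℚ.- v) (ℚP.+-comm v F)) (trans (ℚP.+-assoc F v (ℚ.- v))
                   (trans (cong (F ℚ.+_) (ℚP.+-inverseʳ v)) (ℚP.+-identityʳ F)))

  AdmissibleSeq : List (ℕ × ℕ) → List Request → Set
  AdmissibleSeq s [] = ⊤
  AdmissibleSeq s (r ∷ rs) = Admissible s r × AdmissibleSeq (applyReq s r) rs

  area-run : ∀ s rs → DistinctIds s → AdmissibleSeq s rs → area s ℚ.+ sumℚ (volsFrom s rs) ≡ area (foldl applyReq s rs)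
  area-run s [] u _ = ℚP.+-identityʳ (area s)
  area-run s (r ∷ rs) u (a , as) = begin
    area s ℚ.+ (vol s r ℚ.+ sumℚ (volsFrom (applyReq s r) rs))  ≡⟨ sym (ℚP.+-assoc (area s) (vol s r) _) ⟩
    (area s ℚ.+ vol s r) ℚ.+ sumℚ (volsFrom (applyReq s r) rs)  ≡⟨ cong (ℚ._+ sumℚ (volsFrom (applyReq s r) rs)) (step-area s r u a) ⟩
    area (applyReq s r) ℚ.+ sumℚ (volsFrom (applyReq s r) rs)   ≡⟨ area-run (applyReq s r) rs (DistinctIds-step s r u a) as ⟩
    area (foldl applyReq (applyReq s r) rs)                     ∎
    where open ≡-Reasoning

  volsFrom-prefix : ∀ s pre r post → take (suc (length pre)) (volsFrom s (pre ++ r ∷ post)) ≡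
    volsFrom s pre ++ (vol (foldl applyReq s pre) r ∷ [])
  volsFrom-prefix s [] r post = refl
  volsFrom-prefix s (p ∷ pre) r post = cong (vol s p ∷_) (volsFrom-prefix (applyReq s p) pre r post)

  sumℚ-snoc : ∀ xs y → sumℚ (xs ++ y ∷ []) ≡ sumℚ xs ℚ.+ y
  sumℚ-snoc [] y = trans (ℚP.+-identityʳ y) (sym (ℚP.+-identityˡ y))
  sumℚ-snoc (x ∷ xs) y = trans (cong (x ℚ.+_) (sumℚ-snoc xs y)) (sym (ℚP.+-assoc x (sumℚ xs) y))

  insertion-fits : ∀ pre x ℓ post → Valid (pre ++ insert x ℓ ∷ post) → AdmissibleSeq [] pre →
    (area (live pre) ℚ.+ volOf ℓ) ℚ.≤ 1ℚ
  insertion-fits pre x ℓ post valid adm = subst (ℚ._≤ 1ℚ) prefix-sum (valid (suc (length pre)))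
    where
    prefix-sum : sumℚ (take (suc (length pre)) (volsFrom [] (pre ++ insert x ℓ ∷ post))) ≡ area (live pre) ℚ.+ volOf ℓ
    prefix-sum = begin
      sumℚ (take (suc (length pre)) (volsFrom [] (pre ++ insert x ℓ ∷ post)))
        ≡⟨ cong sumℚ (volsFrom-prefix [] pre (insert x ℓ) post) ⟩
      sumℚ (volsFrom [] pre ++ volOf ℓ ∷ [])     ≡⟨ sumℚ-snoc (volsFrom [] pre) (volOf ℓ) ⟩
      sumℚ (volsFrom [] pre) ℚ.+ volOf ℓ         ≡⟨ cong (ℚ._+ volOf ℓ) (sym (ℚP.+-identityˡ (sumℚ (volsFrom [] pre)))) ⟩
      (0ℚ ℚ.+ sumℚ (volsFrom [] pre)) ℚ.+ volOf ℓ ≡⟨ cong (ℚ._+ volOf ℓ) (area-run [] pre tt adm) ⟩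
      area (live pre) ℚ.+ volOf ℓ                ∎
      where open ≡-Reasoning

module Steps where

  open Pixels
  open Decisions
  open Emptiness
  open Moves
  open DeletionCorrect using (Witnessed; outer-correct)
  open DeletionTerminates using (outer-terminates; rankSum; outerMeasure)
  open ClearCount using (no-clear-pixel-bound)
  open Volume
  open Requests

  record Consistent (s : List (ℕ × ℕ)) (c : Config) : Set where
    field
      represents : squares c ≡ s
      antichain  : Antichain (assigned c)
      compact    : Compact c
      distinct   : DistinctIds s
  open Consistent

  initial : Consistent [] emptyConfig
  initial = record { represents = refl ; antichain = [] ; compact = λ _ () ; distinct = tt }

  ids-squares : ∀ (c : Config) → map proj₁ (squares c) ≡ map proj₁ c
  ids-squares [] = refl
  ids-squares (e ∷ c) = cong (proj₁ e ∷_) (ids-squares c)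

  layers-squares : ∀ (c : Config) → map proj₂ (squares c) ≡ map length (assigned c)
  layers-squares [] = refl
  layers-squares (e ∷ c) = cong (length (proj₂ e) ∷_) (layers-squares c)

  squares-removeId : ∀ c x → squares (removeId c x) ≡ filterB (λ e → not (proj₁ e ≡ᵇ x)) (squares c)
  squares-removeId [] x = refl
  squares-removeId ((i , p) ∷ c) x with i ≡ᵇ x
  ... | true = squares-removeId c x
  ... | false = cong ((i , length p) ∷_) (squares-removeId c x)

  removeId-⊆ : ∀ c x {y} → y ∈ assigned (removeId c x) → y ∈ assigned c
  removeId-⊆ ((i , p) ∷ c) x m with i ≡ᵇ x
  removeId-⊆ ((i , p) ∷ c) x m | true = there (removeId-⊆ c x m)
  removeId-⊆ ((i , p) ∷ c) x (here refl) | false = here refl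
  removeId-⊆ ((i , p) ∷ c) x (there m) | false = there (removeId-⊆ c x m)

  removeId-antichain : ∀ c x → Antichain (assigned c) → Antichain (assigned (removeId c x))
  removeId-antichain [] x w = []
  removeId-antichain ((i , z) ∷ c) x (h ∷ w) with i ≡ᵇ x
  ... | true = removeId-antichain c x w
  ... | false = All.tabulate (λ m → All.lookup h (removeId-⊆ c x m)) ∷ removeId-antichain c x w

  lookupId-present : ∀ c x → x ∈ map proj₁ c → Σ Pixel λ p → lookupId c x ≡ just p
  lookupId-present ((i , p) ∷ c) x m with i ≡ᵇ x in e
  ... | true = p , refl
  lookupId-present ((i , p) ∷ c) .i (here refl) | false = ⊥-elim (true≢false (trans (sym (≡ᵇ-refl i)) e))
  lookupId-present ((i , p) ∷ c) x (there m) | false = lookupId-present c x m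

  lookupId-occupied : ∀ c x {p} → lookupId c x ≡ just p → p ∈ assigned c
  lookupId-occupied ((i , z) ∷ c) x h with i ≡ᵇ x
  lookupId-occupied ((i , z) ∷ c) x refl | true = here refl
  ... | false = there (lookupId-occupied c x h)

  removeId-rest : ∀ c x {p} → DistinctIds (squares c) → lookupId c x ≡ just p →
    ∀ {y} → y ∈ assigned c → y ≡ p ⊎ y ∈ assigned (removeId c x)
  removeId-rest ((i , z) ∷ c) x (n , u) h m with i ≡ᵇ x in e
  removeId-rest ((i , z) ∷ c) x (n , u) refl (here refl) | true = inj₁ refl
  removeId-rest ((i , z) ∷ c) x (n , u) refl (there m) | true rewrite ≡ᵇ-true {i} {x} e =
    inj₂ (subst (λ w → _ ∈ assigned w) (sym (filterB-absent x c (subst (x ∉_) (ids-squares c) n))) m)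
  removeId-rest ((i , z) ∷ c) x (n , u) h (here refl) | false = inj₂ (here refl)
  removeId-rest ((i , z) ∷ c) x (n , u) h (there m) | false with removeId-rest c x u h m
  ... | inj₁ q = inj₁ q
  ... | inj₂ q = inj₂ (there q)

  removeId-clear : ∀ c x {p} → Antichain (assigned c) → DistinctIds (squares c) → lookupId c x ≡ just p →
    Clear (removeId c x) p
  removeId-clear ((i , z) ∷ c) x (h ∷ w) (n , u) found m with i ≡ᵇ x in e
  removeId-clear ((i , z) ∷ c) x (h ∷ w) (n , u) refl m | true rewrite ≡ᵇ-true {i} {x} e =
    All.lookup h (subst (λ v → _ ∈ assigned v) (filterB-absent x c (subst (x ∉_) (ids-squares c) n)) m)
  removeId-clear ((i , z) ∷ c) x (h ∷ w) (n , u) found (here refl) | false =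
    λ nn → All.lookup h (lookupId-occupied c x found) (nested-sym nn)
  removeId-clear ((i , z) ∷ c) x (h ∷ w) (n , u) found (there m) | false = removeId-clear c x w u found m

  deleteFF-start : ∀ n c x p → lookupId c x ≡ just p →
    deleteFF n c x ≡ outer n (maxEmpty (removeId c x) p ∷ []) (removeId c x)
  deleteFF-start n c x p e rewrite e = refl

  -- After removing the square at p from a compact configuration, every
  -- violation involves a pixel nested with p and is witnessed by the topmost
  -- clear ancestor of p, which is where the deletion procedure starts.
  deletion-witnessed : ∀ {s} c x p → Consistent s c → lookupId c x ≡ just p →
    Witnessed (maxEmpty (removeId c x) p ∷ []) (removeId c x)
  deletion-witnessed c x p C found {e} {q} he m l e<q with nested? e p
  ... | inj₁ n = p′ , here refl , p′⊑e n , λ p′⊑q → p′-clear m (inj₁ p′⊑q)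
    where
    c₁ = removeId c x
    p-clear : Clear c₁ p
    p-clear = removeId-clear c x (antichain C) (subst DistinctIds (sym (represents C)) (distinct C)) found
    p′ = maxEmpty c₁ p
    p′-clear : Clear c₁ p′
    p′-clear = proj₁ (maxEmpty-top c₁ p p-clear ⊑-refl)
    p′⊑e : Nested e p → p′ ⊑ e
    p′⊑e (inj₁ e⊑p) = proj₂ (maxEmpty-top c₁ p he e⊑p)
    p′⊑e (inj₂ p⊑e) = ⊑-trans (proj₂ (maxEmpty-top c₁ p p-clear ⊑-refl)) p⊑e
  ... | inj₂ nn = ⊥-elim (compact C clear-before (removeId-⊆ c x m) l e<q)
    where
    clear-before : Clear c e
    clear-before my with removeId-rest c x (subst DistinctIds (sym (represents C)) (distinct C)) found my
    ... | inj₁ refl = nn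
    ... | inj₂ m₁ = he m₁

  present-in-config : ∀ {s c x} → Consistent s c → x ∈ map proj₁ s → x ∈ map proj₁ c
  present-in-config {s} {c} C m = subst (_ ∈_) (trans (cong (map proj₁) (sym (represents C))) (ids-squares c)) m

  deletion-terminates : ∀ {s} c x → Consistent s c → x ∈ map proj₁ s →
    Σ ℕ λ n → Σ Config λ c′ → deleteFF n c x ≡ just c′
  deletion-terminates c x C present with lookupId-present c x (present-in-config C present)
  ... | p , found with outer-terminates (rankSum c₁) (outerMeasure S₀ c₁) S₀ c₁ ℕP.≤-refl ℕP.≤-refl
    where
    c₁ = removeId c x
    S₀ = maxEmpty c₁ p ∷ []
  ... | n , c′ , h = n , c′ , trans (deleteFF-start n c x p found) h

  deletion-consistent : ∀ {s} n c x → Consistent s c → x ∈ map proj₁ s → ∀ {c′} → deleteFF n c x ≡ just c′ →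
    Consistent (applyReq s (delete x)) c′
  deletion-consistent {s} n c x C present {c′} h with lookupId-present c x (present-in-config C present)
  ... | p , found with outer-correct n _ _ (removeId-antichain c x (antichain C)) (deletion-witnessed c x p C found)
                         (trans (sym (deleteFF-start n c x p found)) h)
  ... | compact′ , antichain′ , same = record
    { represents = trans same (trans (squares-removeId c x) (cong (filterB (λ e → not (proj₁ e ≡ᵇ x))) (represents C)))
    ; antichain = antichain′
    ; compact = compact′
    ; distinct = DistinctIds-step s (delete x) (distinct C) present
    }

  -- The sum of the layers of the occupied pixels bounds each of them; it
  -- serves as a layer below all squares.
  layerTotal : List Pixel → ℕ
  layerTotal [] = 0
  layerTotal (x ∷ xs) = length x + layerTotal xs

  layerTotal-≥ : ∀ xs {x} → x ∈ xs → length x ≤ layerTotal xs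
  layerTotal-≥ (x ∷ xs) (here refl) = ℕP.m≤m+n (length x) _
  layerTotal-≥ (y ∷ xs) (there m) = ℕP.≤-trans (layerTotal-≥ xs m) (ℕP.m≤n+m _ (length y))

  -- An insertion that fits finds an empty pixel: otherwise, on the layer
  -- D = K + ℓ below all squares, counting (no-clear-pixel-bound) and volume
  -- (volume-bound) give 4^D + 1 ≤ N + 4^K ≤ 4^D.
  insertion-finds : ∀ {s} c ℓ → Consistent s c → (area s ℚ.+ volOf ℓ) ℚ.≤ 1ℚ → Σ Pixel λ p → firstEmpty c ℓ ≡ just p
  insertion-finds c ℓ C fits with firstEmpty c ℓ in eq
  ... | just p = p , refl
  ... | nothing = ⊥-elim (ℕP.<-irrefl refl (begin-strict
      4 ^ D         <⟨ ℕP.m<m+n (4 ^ D) (s≤s z≤n) ⟩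
      4 ^ D + 1     ≤⟨ no-clear-pixel-bound c (compact C) ℓ K none deep ⟩
      N + 4 ^ K     ≡⟨ cong₂ _+_ (cong sum (LP.map-∘ (assigned c))) (cong (4 ^_) (sym (ℕP.m+n∸n≡m K ℓ))) ⟩
      N′ + 4 ^ (D ∸ ℓ) ≤⟨ volume-bound D ℓ (map length (assigned c)) (ℕP.m≤n+m ℓ K) deep′ fits′ ⟩
      4 ^ D         ∎))
    where
    open ℕP.≤-Reasoning
    K = layerTotal (assigned c)
    D = K + ℓ
    N = sum (map (λ x → 4 ^ (D ∸ length x)) (assigned c))
    N′ = sum (map (λ l → 4 ^ (D ∸ l)) (map length (assigned c)))
    none : ∀ Q → length Q ≡ ℓ → ¬ Clear c Q
    none Q l = firstEmptyIn-nothing c [] ℓ eq root⊑ l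
    deep : ∀ {x} → x ∈ assigned c → length x ≤ D
    deep m = ℕP.≤-trans (layerTotal-≥ (assigned c) m) (ℕP.m≤m+n K ℓ)
    deep′ : ∀ {l} → l ∈ map length (assigned c) → l ≤ D
    deep′ m with ∈-map⁻ length m
    ... | x , mx , refl = deep mx
    fits′ : (volume (map length (assigned c)) ℚ.+ volOf ℓ) ℚ.≤ 1ℚ
    fits′ = subst (λ ls → (volume ls ℚ.+ volOf ℓ) ℚ.≤ 1ℚ) (trans (cong (map proj₂) (sym (represents C))) (layers-squares c)) fits

  insertion-compact : ∀ c x p ℓ → Compact c → firstEmpty c ℓ ≡ just p → Compact ((x , p) ∷ c)
  insertion-compact c x p ℓ compact′ eq he (here refl) l e<p with firstEmptyIn-just c [] ℓ eq
  ... | _ , p-layer , _ , first = first root⊑ (trans l p-layer) (λ m → he (there m)) e<p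
  insertion-compact c x p ℓ compact′ eq he (there m) l e<q = compact′ (λ m → he (there m)) m l e<q

  insertion-consistent : ∀ {s} c x ℓ p → Consistent s c → x ∉ map proj₁ s → firstEmpty c ℓ ≡ just p →
    Consistent (applyReq s (insert x ℓ)) ((x , p) ∷ c)
  insertion-consistent c x ℓ p C fresh eq with firstEmptyIn-just c [] ℓ eq
  ... | _ , p-layer , p-clear , _ = record
    { represents = cong₂ _∷_ (cong (x ,_) p-layer) (represents C)
    ; antichain = All.tabulate (λ m → p-clear m) ∷ antichain C
    ; compact = insertion-compact c x p ℓ (compact C) eq
    ; distinct = fresh , distinct C
    }

  insertion-step : ∀ n c x ℓ p → firstEmpty c ℓ ≡ just p → ffStep n c (insert x ℓ) ≡ just ((x , p) ∷ c)
  insertion-step n c x ℓ p eq rewrite eq = refl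

  insertion-handled : ∀ {s} c x ℓ p → Consistent s c → firstEmpty c ℓ ≡ just p → Handles c (insert x ℓ)
  insertion-handled c x ℓ p C eq with firstEmptyIn-just c [] ℓ eq
  ... | _ , p-layer , p-clear , _ =
    p , Clear⇒Empty {c} {p} p-clear , p-layer , eq , insertion-step 0 c x ℓ p eq ,
    Compact⇒Invariant {(x , p) ∷ c} (insertion-compact c x p ℓ (compact C) eq)

  deletion-handled : ∀ {s} c x → Consistent s c → x ∈ map proj₁ s → Handles c (delete x)
  deletion-handled c x C present with deletion-terminates c x C present
  ... | n , c′ , h = n , c′ , h , Compact⇒Invariant {c′} (compact (deletion-consistent n c x C present h))

open Requests using (AdmissibleSeq; insertion-fits; area)
open Steps

live-snoc : ∀ pre r → live (pre ++ r ∷ []) ≡ applyReq (live pre) r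
live-snoc pre r = LP.foldl-++ applyReq [] pre (r ∷ [])

module Processing (rs : List Request) (wf : WellFormed rs) (valid : Valid rs) where

  admissible : ∀ pre₀ pre post → rs ≡ pre₀ ++ pre ++ post → AdmissibleSeq (live pre₀) pre
  admissible pre₀ [] post e = tt
  admissible pre₀ (r ∷ pre) post e =
    wf pre₀ r (pre ++ post) e ,
    subst (λ s → AdmissibleSeq s pre) (live-snoc pre₀ r)
      (admissible (pre₀ ++ r ∷ []) pre post (trans e (sym (LP.++-assoc pre₀ (r ∷ []) (pre ++ post)))))

  fits : ∀ pre x ℓ post → rs ≡ pre ++ insert x ℓ ∷ post → (area (live pre) ℚ.+ volOf ℓ) ℚ.≤ 1ℚ
  fits pre x ℓ post e = insertion-fits pre x ℓ post (subst Valid e valid) (admissible [] pre (insert x ℓ ∷ post) e)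

  succeeds : ∀ pre r post c → rs ≡ pre ++ r ∷ post → Consistent (live pre) c →
    Σ ℕ λ n → Σ Config λ c′ → ffStep n c r ≡ just c′
  succeeds pre (insert x ℓ) post c e C with insertion-finds c ℓ C (fits pre x ℓ post e)
  ... | p , found = 0 , _ , insertion-step 0 c x ℓ p found
  succeeds pre (delete x) post c e C = deletion-terminates c x C (wf pre (delete x) post e)

  consistent : ∀ pre r post c n c′ → rs ≡ pre ++ r ∷ post → Consistent (live pre) c → ffStep n c r ≡ just c′ →
    Consistent (live (pre ++ r ∷ [])) c′
  consistent pre (insert x ℓ) post c n c′ e C h with insertion-finds c ℓ C (fits pre x ℓ post e)
  ... | p , found with just-injective (trans (sym h) (insertion-step n c x ℓ p found))
  ... | refl = subst (λ s → Consistent s c′) (sym (live-snoc pre (insert x ℓ)))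
                 (insertion-consistent c x ℓ p C (wf pre (insert x ℓ) post e) found)
  consistent pre (delete x) post c n c′ e C h =
    subst (λ s → Consistent s c′) (sym (live-snoc pre (delete x))) (deletion-consistent n c x C (wf pre (delete x) post e) h)

  handled : ∀ pre r post c → rs ≡ pre ++ r ∷ post → Consistent (live pre) c → Handles c r
  handled pre (insert x ℓ) post c e C with insertion-finds c ℓ C (fits pre x ℓ post e)
  ... | p , found = insertion-handled c x ℓ p C found
  handled pre (delete x) post c e C = deletion-handled c x C (wf pre (delete x) post e)

  runs : ∀ pre post c → rs ≡ pre ++ post → Consistent (live pre) c → Σ Config λ c″ → Run c post c″
  runs pre [] c e C = c , done
  runs pre (r ∷ post) c e C with succeeds pre r post c e C
  ... | n , c′ , h with runs (pre ++ r ∷ []) post c′ (trans e (sym (LP.++-assoc pre (r ∷ []) post))) (consistent pre r post c n c′ e C h)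
  ... | c″ , run = c″ , step n h run

  run-consistent : ∀ pre mid post c c″ → rs ≡ pre ++ mid ++ post → Consistent (live pre) c → Run c mid c″ →
    Consistent (live (pre ++ mid)) c″
  run-consistent pre [] post c .c e C done = subst (λ t → Consistent (live t) c) (sym (LP.++-identityʳ pre)) C
  run-consistent pre (r ∷ mid) post c c″ e C (step {c′ = c′} n h run) =
    subst (λ t → Consistent (live t) c″) (LP.++-assoc pre (r ∷ []) mid)
      (run-consistent (pre ++ r ∷ []) mid post c′ c″ (trans e (sym (LP.++-assoc pre (r ∷ []) (mid ++ post))))
         (consistent pre r (mid ++ post) c n c′ e C h) run)

theorem6 : (rs : List Request) → WellFormed rs → Valid rs →
    (Σ Config λ c → Run emptyConfig rs c) ×
    (∀ pre r post c → rs ≡ pre ++ r ∷ post → Run emptyConfig pre c → Handles c r)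
theorem6 rs wf valid =
  runs [] rs emptyConfig refl initial ,
  λ pre r post c split run → handled pre r post c split (run-consistent [] pre (r ∷ post) emptyConfig c split initial run)
  where open Processing rs wf valid
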